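{- For every nonempty connected graph $\Gamma$, $\mathrm{HP}(\Gamma)\le(-1)^{|V_\Gamma|}\chi_\Gamma(-1)$, and equality holds if and only if $\Gamma$ is a complete graph.
   Context: Graphs are finite, simple, undirected. $\mathrm{HP}(\Gamma)$ is the number of directed Hamiltonian paths of $\Gamma$ (orderings $(v_1,\dots,v_n)$ of all vertices with $v_i$ adjacent to $v_{i+1}$). $\chi_\Gamma(q)$ is the chromatic polynomial, so $(-1)^{|V_\Gamma|}\chi_\Gamma(-1)$ is the number of acyclic orientations of $\Gamma$. -}

module Defs where

open import Data.Bool using (Bool; true; false; _∧_; not)
open import Data.Nat using (ℕ; zero; suc)
open import Data.Fin using (Fin; zero; suc)
open import Data.Fin.Properties using (_≟_)
open import Data.Integer as ℤ using (ℤ; +_; -_)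
open import Data.List using (List; []; _∷_; map; concatMap; length; filter; allFin)
open import Data.Vec using (Vec; []; _∷_; lookup)
open import Data.Product using (Σ; _×_; _,_)
open import Relation.Binary.PropositionalEquality using (_≡_; _≢_)
open import Relation.Nullary.Decidable using (⌊_⌋)

all : ∀ {A : Set} → (A → Bool) → List A → Bool
all p []       = true
all p (x ∷ xs) = p x ∧ all p xs

record Graph (n : ℕ) : Set where
  field
    adj    : Fin n → Fin n → Bool
    sym    : ∀ u v → adj u v ≡ adj v u
    irrefl : ∀ v → adj v v ≡ false
open Graph public

data Walk {n : ℕ} (G : Graph n) : Fin n → Fin n → Set where
  here : ∀ {v} → Walk G v v
  step : ∀ {u w v} → adj G u w ≡ true → Walk G w v → Walk G u v

Connected : ∀ {n} → Graph n → Set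
Connected G = ∀ u v → Walk G u v

Complete : ∀ {n} → Graph n → Set
Complete {n} G = ∀ (u v : Fin n) → u ≢ v → adj G u v ≡ true

allVecs : (k q : ℕ) → List (Vec (Fin q) k)
allVecs zero    q = [] ∷ []
allVecs (suc k) q = concatMap (λ x → map (x ∷_) (allVecs k q)) (allFin q)

count : ∀ {A : Set} → (A → Bool) → List A → ℕ
count p xs = length (filter (λ x → Data.Bool._≟_ (p x) true) xs)
  where import Data.Bool

isProper : ∀ {n q} → Graph n → Vec (Fin q) n → Bool
isProper {n} G c =
  all (λ u → all (λ v → not (adj G u v) Data.Bool.∨ not ⌊ lookup c u ≟ lookup c v ⌋)
                 (allFin n))
      (allFin n)
  where import Data.Bool

numColourings : ∀ {n} → Graph n → ℕ → ℕ
numColourings {n} G q = count (isProper G) (allVecs n q)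

-- Is the sequence of vertices (v_1,...,v_n) a directed Hamiltonian path:
-- all entries distinct (hence a listing of all vertices) and consecutive ones adjacent.
consecAdj : ∀ {n k} → Graph n → Vec (Fin n) k → Bool
consecAdj G []           = true
consecAdj G (x ∷ [])     = true
consecAdj G (x ∷ y ∷ xs) = adj G x y ∧ consecAdj G (y ∷ xs)

injective : ∀ {n k} → Vec (Fin n) k → Bool
injective {n} {k} xs =
  all (λ i → all (λ j → ⌊ i ≟ j ⌋ Data.Bool.∨ not ⌊ lookup xs i ≟ lookup xs j ⌋)
                 (allFin k))
      (allFin k)
  where import Data.Bool

isHamPath : ∀ {n} → Graph n → Vec (Fin n) n → Bool
isHamPath G xs = injective xs ∧ consecAdj G xs

HP : ∀ {n} → Graph n → ℕ
HP {n} G = count (isHamPath G) (allVecs n n)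

-- Integer polynomials as coefficient lists (constant term first), Horner evaluation.
Poly : Set
Poly = List ℤ

eval : Poly → ℤ → ℤ
eval []       x = + 0
eval (a ∷ as) x = a ℤ.+ x ℤ.* eval as x

-- P is the chromatic polynomial of G: P(q) = number of proper q-colourings for all q ∈ ℕ.
-- (A polynomial is determined by its values on ℕ, so this pins down χ_G uniquely.)
IsChromaticPoly : ∀ {n} → Graph n → Poly → Set
IsChromaticPoly G P = ∀ (q : ℕ) → eval P (+ q) ≡ + numColourings G q

negOnePow : ℕ → ℤ
negOnePow zero    = + 1
negOnePow (suc n) = - negOnePow n

-- Both sides are compared through the number AO(G) of acyclic orientations.
--
-- Stanley: (-1)^n χ_G(-1) = AO(G). Deleting an edge e = ab and contracting it gives
-- χ_{G-e} = χ_G + χ_{G/e} (split the colourings of G - e by whether a and b agree) and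
-- AO(G) = AO(G-e) + AO(G/e): an acyclic orientation of G - e extends to one of G by a → b, by b → a,
-- or by both, and those extending both ways are exactly the ones that rank a and b equally, i.e. the
-- lifts of acyclic orientations of G/e. Running the recursion down to edgeless graphs builds a
-- polynomial with both properties, and a polynomial is determined by its values on ℕ.
--
-- Orienting each edge along a Hamiltonian path injects Hamiltonian paths into acyclic orientations,
-- as a directed Hamiltonian path of an acyclic orientation is its unique linear extension. For a complete
-- graph every acyclic orientation is a linear order, hence comes from a path; if u and v are not adjacent,
-- the acyclic orientation in which both are sources comes from no path.
module Submission where

module Counting where

  open import Defs using (count; allVecs)
  open import Data.Bool using (true; _≟_)
  open import Data.Nat using (ℕ; zero; suc; _+_; _*_; _^_; _≤_; _<_; z≤n; s≤s)
  open import Data.Nat.Properties using (+-suc; m≤n⇒m≤1+n; ≤-antisym)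
  open import Data.Fin using (Fin)
  open import Data.List using (List; []; _∷_; _++_; [_]; map; concatMap; filter; length; allFin; cartesianProductWith)
  open import Data.List.Properties using (length-++; length-map)
  open import Data.List.Membership.Propositional using (_∈_)
  open import Data.List.Membership.Propositional.Properties
    using (∈-∃++; ∈-++⁻; ∈-++⁺ˡ; ∈-++⁺ʳ; ∈-filter⁺; ∈-allFin; ∈-cartesianProductWith⁺)
  open import Data.List.Relation.Unary.Any using (here; there)
  open import Data.List.Relation.Unary.All as All using (All; []; _∷_)
  open import Data.List.Relation.Unary.AllPairs using ([]; _∷_)
  open import Data.List.Relation.Unary.Unique.Propositional using (Unique)
  import Data.List.Relation.Unary.Unique.Propositional.Properties as Unique
  open import Data.Vec using (Vec; []; _∷_)
  open import Data.Vec.Properties using (∷-injective)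
  open import Data.Product using (∃₂; _×_; _,_)
  open import Data.Sum using (inj₁; inj₂)
  open import Function.Bundles using (_⇔_; Equivalence)
  open import Relation.Binary.PropositionalEquality
    using (_≡_; _≢_; refl; sym; trans; cong; cong₂; subst; subst₂)
  open import Relation.Nullary using (¬_; yes; no; does; contradiction)
  open import Relation.Nullary.Decidable using (dec-true)
  open import Level using (0ℓ)
  open import Relation.Unary using (Pred; Decidable)
  open import Relation.Unary.Properties using (_∩?_; _∪?_; ∁?)

  private variable
    A C : Set

  record Enumeration (A : Set) : Set where
    field
      elements : List A
      unique   : Unique elements
      complete : ∀ a → a ∈ elements
  open Enumeration public

  #[_]_ : {P : Pred A 0ℓ} → Decidable P → List A → ℕ
  #[ P? ] xs = count (λ x → does (P? x)) xs

  infix 9 #[_]_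

  module _ {P : Pred A 0ℓ} (P? : Decidable P) where

    #-accept : ∀ {x} xs → P x → #[ P? ] (x ∷ xs) ≡ suc (#[ P? ] xs)
    #-accept {x} xs px with P? x
    ... | yes _  = refl
    ... | no ¬px = contradiction px ¬px

    #-reject : ∀ {x} xs → ¬ P x → #[ P? ] (x ∷ xs) ≡ #[ P? ] xs
    #-reject {x} xs ¬px with P? x
    ... | yes px = contradiction px ¬px
    ... | no _   = refl

    #-all : ∀ xs → (∀ x → P x) → #[ P? ] xs ≡ length xs
    #-all []       _   = refl
    #-all (x ∷ xs) every = trans (#-accept xs (every x)) (cong suc (#-all xs every))

    #-split : {R : Pred A 0ℓ} (R? : Decidable R) → ∀ xs →
              #[ P? ] xs ≡ #[ P? ∩? R? ] xs + #[ P? ∩? ∁? R? ] xs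
    #-split R? [] = refl
    #-split R? (x ∷ xs) with P? x | R? x
    ... | yes _ | yes _ = cong suc (#-split R? xs)
    ... | yes _ | no _  = trans (cong suc (#-split R? xs)) (sym (+-suc _ _))
    ... | no _  | _     = #-split R? xs

  module _ {P Q : Pred A 0ℓ} (P? : Decidable P) (Q? : Decidable Q) where

    #-cong : (∀ x → P x ⇔ Q x) → ∀ xs → #[ P? ] xs ≡ #[ Q? ] xs
    #-cong P⇔Q []       = refl
    #-cong P⇔Q (x ∷ xs) with P? x | Q? x
    ... | yes _  | yes _  = cong suc (#-cong P⇔Q xs)
    ... | no _   | no _   = #-cong P⇔Q xs
    ... | yes px | no ¬qx = contradiction (Equivalence.to (P⇔Q x) px) ¬qx
    ... | no ¬px | yes qx = contradiction (Equivalence.from (P⇔Q x) qx) ¬px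

    #-union+inter : ∀ xs → #[ P? ] xs + #[ Q? ] xs ≡ #[ P? ∪? Q? ] xs + #[ P? ∩? Q? ] xs
    #-union+inter [] = refl
    #-union+inter (x ∷ xs) with P? x | Q? x
    ... | yes _ | yes _ = cong suc (trans (+-suc _ _) (trans (cong suc (#-union+inter xs)) (sym (+-suc _ _))))
    ... | yes _ | no _  = cong suc (#-union+inter xs)
    ... | no _  | yes _ = trans (+-suc _ _) (cong suc (#-union+inter xs))
    ... | no _  | no _  = #-union+inter xs

    #-mono : (∀ {x} → P x → Q x) → ∀ xs → #[ P? ] xs ≤ #[ Q? ] xs
    #-mono P⊆Q [] = z≤n
    #-mono P⊆Q (x ∷ xs) with P? x | Q? x
    ... | yes _  | yes _  = s≤s (#-mono P⊆Q xs)
    ... | no _   | yes _  = m≤n⇒m≤1+n (#-mono P⊆Q xs)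
    ... | no _   | no _   = #-mono P⊆Q xs
    ... | yes px | no ¬qx = contradiction (P⊆Q px) ¬qx

    #-mono-< : (∀ {x} → P x → Q x) → ∀ {y xs} → y ∈ xs → Q y → ¬ P y →
               #[ P? ] xs < #[ Q? ] xs
    #-mono-< P⊆Q {xs = _ ∷ xs} (here refl) qy ¬py =
      subst₂ _<_ (sym (#-reject P? xs ¬py)) (sym (#-accept Q? xs qy)) (s≤s (#-mono P⊆Q xs))
    #-mono-< P⊆Q {xs = x ∷ xs} (there y∈xs) qy ¬py with P? x | Q? x
    ... | yes _  | yes _  = s≤s (#-mono-< P⊆Q y∈xs qy ¬py)
    ... | no _   | yes _  = m≤n⇒m≤1+n (#-mono-< P⊆Q y∈xs qy ¬py)
    ... | no _   | no _   = #-mono-< P⊆Q y∈xs qy ¬py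
    ... | yes px | no ¬qx = contradiction (P⊆Q px) ¬qx

  Unique-⊆⇒length-≤ : {xs ys : List A} → Unique xs → (∀ {x} → x ∈ xs → x ∈ ys) →
                      length xs ≤ length ys
  Unique-⊆⇒length-≤ {xs = []} _ _ = z≤n
  Unique-⊆⇒length-≤ {xs = x ∷ xs} (x∉xs ∷ unique) xs⊆ys with ∈-∃++ (xs⊆ys (here refl))
  ... | us , vs , refl = subst (suc (length xs) ≤_) (sym length-us++x∷vs) (s≤s (Unique-⊆⇒length-≤ unique ⊆us++vs))
    where
    length-us++x∷vs : length (us ++ x ∷ vs) ≡ suc (length (us ++ vs))
    length-us++x∷vs = trans (length-++ us) (trans (+-suc (length us) (length vs)) (cong suc (sym (length-++ us))))
    ⊆us++vs : ∀ {z} → z ∈ xs → z ∈ us ++ vs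
    ⊆us++vs {z} z∈xs with ∈-++⁻ us (xs⊆ys (there z∈xs))
    ... | inj₁ z∈us         = ∈-++⁺ˡ z∈us
    ... | inj₂ (there z∈vs) = ∈-++⁺ʳ us z∈vs
    ... | inj₂ (here refl)  = contradiction refl (All.lookup x∉xs z∈xs)

  module _ {P : Pred A 0ℓ} {Q : Pred C 0ℓ} (P? : Decidable P) (Q? : Decidable Q)
           (f : ∀ a → P a → C) (f-Q : ∀ a pa → Q (f a pa))
           (f-injective : ∀ {a a'} pa pa' → f a pa ≡ f a' pa' → a ≡ a') where

    private
      image : List A → List C
      image [] = []
      image (a ∷ as) with P? a
      ... | yes pa = f a pa ∷ image as
      ... | no _   = image as

      length-image : ∀ as → length (image as) ≡ #[ P? ] as
      length-image [] = refl
      length-image (a ∷ as) with P? a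
      ... | yes _ = cong suc (length-image as)
      ... | no _  = length-image as

      image-source : ∀ {c} as → c ∈ image as → ∃₂ λ a pa → a ∈ as × f a pa ≡ c
      image-source (a ∷ as) c∈ with P? a
      image-source (a ∷ as) (here refl) | yes pa = a , pa , here refl , refl
      image-source (a ∷ as) (there c∈) | yes _ with image-source as c∈
      ... | a' , pa' , a'∈as , refl = a' , pa' , there a'∈as , refl
      image-source (a ∷ as) c∈ | no _ with image-source as c∈
      ... | a' , pa' , a'∈as , refl = a' , pa' , there a'∈as , refl

      image-unique : ∀ {as} → Unique as → Unique (image as)
      image-unique [] = []
      image-unique {a ∷ as} (a∉as ∷ unique) with P? a
      ... | no _   = image-unique unique
      ... | yes pa = All.tabulate fa∉ ∷ image-unique unique
        where
        fa∉ : ∀ {c} → c ∈ image as → f a pa ≢ c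
        fa∉ c∈ refl with image-source as c∈
        ... | a' , pa' , a'∈as , eq = All.lookup a∉as a'∈as (f-injective pa pa' (sym eq))

      image⊆ : ∀ as {ys} → (∀ c → c ∈ ys) → ∀ {c} → c ∈ image as → c ∈ filter (λ y → does (Q? y) ≟ true) ys
      image⊆ as complete c∈ with image-source as c∈
      ... | a , pa , _ , refl = ∈-filter⁺ _ (complete (f a pa)) (dec-true (Q? _) (f-Q a pa))

    #-≤-injection : ∀ {xs ys} → Unique xs → (∀ c → c ∈ ys) → #[ P? ] xs ≤ #[ Q? ] ys
    #-≤-injection {xs} unique complete =
      subst (_≤ _) (length-image xs) (Unique-⊆⇒length-≤ (image-unique unique) (image⊆ xs complete))

    #-<-injection : ∀ {xs ys} → Unique xs → (∀ c → c ∈ ys) →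
                    ∀ c → Q c → (∀ a pa → f a pa ≢ c) → #[ P? ] xs < #[ Q? ] ys
    #-<-injection {xs} {ys} unique complete c qc missed =
      subst (λ k → suc k ≤ _) (length-image xs) (Unique-⊆⇒length-≤ (All.tabulate c∉ ∷ image-unique unique) ⊆)
      where
      c∉ : ∀ {c'} → c' ∈ image xs → c ≢ c'
      c∉ c'∈ refl with image-source xs c'∈
      ... | a , pa , _ , eq = missed a pa eq
      ⊆ : ∀ {c'} → c' ∈ c ∷ image xs → c' ∈ filter (λ y → does (Q? y) ≟ true) ys
      ⊆ (here refl) = ∈-filter⁺ _ (complete c) (dec-true (Q? c) qc)
      ⊆ (there c'∈) = image⊆ xs complete c'∈

  module _ {P : Pred A 0ℓ} {Q : Pred C 0ℓ} (P? : Decidable P) (Q? : Decidable Q)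
           (EA : Enumeration A) (EC : Enumeration C) (f : A → C) (g : C → A)
           (f-Q : ∀ {a} → P a → Q (f a)) (g-P : ∀ {c} → Q c → P (g c))
           (g∘f : ∀ {a} → P a → g (f a) ≡ a) (f∘g : ∀ {c} → Q c → f (g c) ≡ c) where

    #-bijection : #[ P? ] elements EA ≡ #[ Q? ] elements EC
    #-bijection = ≤-antisym
      (#-≤-injection P? Q? (λ a _ → f a) (λ _ → f-Q) (λ pa pa' eq → trans (sym (g∘f pa)) (trans (cong g eq) (g∘f pa')))
                     (unique EA) (complete EC))
      (#-≤-injection Q? P? (λ c _ → g c) (λ _ → g-P) (λ qc qc' eq → trans (sym (f∘g qc)) (trans (cong f eq) (f∘g qc')))
                     (unique EC) (complete EA))

  finEnumeration : ∀ n → Enumeration (Fin n)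
  finEnumeration n = record { elements = allFin n ; unique = Unique.allFin⁺ n ; complete = ∈-allFin }

  vectors : List A → ∀ n → List (Vec A n)
  vectors xs zero    = [ [] ]
  vectors xs (suc n) = cartesianProductWith _∷_ xs (vectors xs n)

  vecEnumeration : Enumeration A → ∀ n → Enumeration (Vec A n)
  vecEnumeration E n = record { elements = vectors (elements E) n ; unique = unique′ n ; complete = complete′ }
    where
    unique′ : ∀ n → Unique (vectors (elements E) n)
    unique′ zero    = [] ∷ []
    unique′ (suc n) = Unique.cartesianProductWith⁺ _∷_ ∷-injective (unique E) (unique′ n)
    complete′ : ∀ {n} (v : Vec _ n) → v ∈ vectors (elements E) n
    complete′ []       = here refl
    complete′ (x ∷ v) = ∈-cartesianProductWith⁺ _∷_ (complete E x) (complete′ v)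

  length-vectors : (xs : List A) → ∀ n → length (vectors xs n) ≡ length xs ^ n
  length-vectors xs zero    = refl
  length-vectors xs (suc n) = trans (length-product xs) (cong (length xs *_) (length-vectors xs n))
    where
    length-product : ∀ ys {zs : List (Vec _ n)} → length (cartesianProductWith _∷_ ys zs) ≡ length ys * length zs
    length-product []       = refl
    length-product (y ∷ ys) {zs} =
      trans (length-++ (map (y ∷_) zs)) (cong₂ _+_ (length-map (y ∷_) zs) (length-product ys))

  finVectors : ∀ n q → Enumeration (Vec (Fin q) n)
  finVectors n q = vecEnumeration (finEnumeration q) n

  allVecs≡finVectors : ∀ k q → allVecs k q ≡ elements (finVectors k q)
  allVecs≡finVectors zero    q = refl
  allVecs≡finVectors (suc k) q =
    trans (cong (λ vs → concatMap (λ x → map (x ∷_) vs) (allFin q)) (allVecs≡finVectors k q))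
          (concatMap≡product (allFin q))
    where
    concatMap≡product : ∀ xs {vs : List (Vec (Fin q) k)} →
                        concatMap (λ x → map (x ∷_) vs) xs ≡ cartesianProductWith _∷_ xs vs
    concatMap≡product []           = refl
    concatMap≡product (x ∷ xs) {vs} = cong (map (x ∷_) vs ++_) (concatMap≡product xs)

module Polynomial where

  open import Defs using (Poly; eval; negOnePow)
  open import Data.Nat as ℕ using (ℕ; zero; suc; _≤_; s≤s)
  open import Data.Nat.Properties as ℕ using (≤-refl; <⇒≤; <-irrefl)
  open import Data.Integer using (ℤ; +_; -_; _+_; _-_; _*_)
  open import Data.Integer.Properties
    using (i*j≡0⇒i≡0∨j≡0; i-j≡0⇒i≡j; +-inverseʳ; +-injective; +-identityˡ; -1*i≡-i; pos-*)
  open import Data.Integer.Tactic.RingSolver using (solve-∀)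
  open import Data.List using ([]; _∷_; length)
  open import Data.Sum using (inj₁; inj₂)
  open import Relation.Binary.PropositionalEquality
    using (_≡_; refl; sym; trans; cong; subst; module ≡-Reasoning)
  open import Relation.Nullary using (contradiction)

  infixl 6 _⊖_

  _⊖_ : Poly → Poly → Poly
  []      ⊖ []      = []
  []      ⊖ (b ∷ Q) = (- b) ∷ ([] ⊖ Q)
  (a ∷ P) ⊖ []      = a ∷ P
  (a ∷ P) ⊖ (b ∷ Q) = (a - b) ∷ (P ⊖ Q)

  eval-⊖ : ∀ P Q x → eval (P ⊖ Q) x ≡ eval P x - eval Q x
  eval-⊖ []      []      x = refl
  eval-⊖ []      (b ∷ Q) x = trans (cong (λ e → - b + x * e) (eval-⊖ [] Q x)) (lemma b x (eval Q x))
    where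
    lemma : ∀ b x q → - b + x * (+ 0 - q) ≡ + 0 - (b + x * q)
    lemma = solve-∀
  eval-⊖ (a ∷ P) []      x = sym (lemma a x (eval P x))
    where
    lemma : ∀ a x p → a + x * p - + 0 ≡ a + x * p
    lemma = solve-∀
  eval-⊖ (a ∷ P) (b ∷ Q) x = trans (cong (λ e → a - b + x * e) (eval-⊖ P Q x)) (lemma a b x (eval P x) (eval Q x))
    where
    lemma : ∀ a b x p q → a - b + x * (p - q) ≡ (a + x * p) - (b + x * q)
    lemma = solve-∀

  -- Synthetic division by (x - r): the coefficients of the quotient are the Horner values of the tails at r.
  quotient : Poly → ℤ → Poly
  quotient []            r = []
  quotient (a ∷ [])      r = []
  quotient (a ∷ P@(_ ∷ _)) r = eval P r ∷ quotient P r

  length-quotient : ∀ a P r → length (quotient (a ∷ P) r) ≡ length P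
  length-quotient a []      r = refl
  length-quotient a (b ∷ P) r = cong suc (length-quotient b P r)

  factor-theorem : ∀ P x r → eval P x ≡ eval P r + (x - r) * eval (quotient P r) x
  factor-theorem []              x r = lemma x r
    where
    lemma : ∀ x r → + 0 ≡ + 0 + (x - r) * + 0
    lemma = solve-∀
  factor-theorem (a ∷ [])        x r = lemma a x r
    where
    lemma : ∀ a x r → a + x * + 0 ≡ (a + r * + 0) + (x - r) * + 0
    lemma = solve-∀
  factor-theorem (a ∷ P@(_ ∷ _)) x r =
    trans (cong (λ e → a + x * e) (factor-theorem P x r)) (lemma a x r (eval P r) (eval (quotient P r) x))
    where
    lemma : ∀ a x r s q → a + x * (s + (x - r) * q) ≡ (a + r * s) + (x - r) * (s + x * q)
    lemma = solve-∀

  -- Divide out the root m: the quotient, one coefficient shorter, still vanishes at every q ≥ m + 1.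
  vanishes-everywhere : ∀ n P m → length P ≤ n → (∀ q → m ≤ q → eval P (+ q) ≡ + 0) →
                        ∀ x → eval P x ≡ + 0
  vanishes-everywhere n       []      m _ _ x = refl
  vanishes-everywhere (suc n) (a ∷ P) m (s≤s P≤n) vanish x = begin
    eval (a ∷ P) x                       ≡⟨ factor-theorem (a ∷ P) x (+ m) ⟩
    eval (a ∷ P) (+ m) + (x - + m) * q x  ≡⟨ cong (_+ (x - + m) * q x) (vanish m ≤-refl) ⟩
    + 0 + (x - + m) * q x                ≡⟨ cong (λ e → + 0 + (x - + m) * e) (vanishes-everywhere n Q (suc m) Q≤n Q-vanish x) ⟩
    + 0 + (x - + m) * + 0                ≡⟨ times-zero x (+ m) ⟩
    + 0                                  ∎
    where
    open ≡-Reasoning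
    Q = quotient (a ∷ P) (+ m)
    q = eval Q
    Q≤n : length Q ≤ n
    Q≤n = subst (_≤ n) (sym (length-quotient a P (+ m))) P≤n
    times-zero : ∀ x r → + 0 + (x - r) * + 0 ≡ + 0
    times-zero = solve-∀
    plus-zero : ∀ y → + 0 + y ≡ y
    plus-zero = solve-∀
    Q-vanish : ∀ k → suc m ≤ k → q (+ k) ≡ + 0
    Q-vanish k m<k with i*j≡0⇒i≡0∨j≡0 (+ k - + m) product≡0
      where
      product≡0 : (+ k - + m) * q (+ k) ≡ + 0
      product≡0 = begin
        (+ k - + m) * q (+ k)                          ≡⟨ sym (plus-zero _) ⟩
        + 0 + (+ k - + m) * q (+ k)                     ≡⟨ cong (_+ (+ k - + m) * q (+ k)) (sym (vanish m ≤-refl)) ⟩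
        eval (a ∷ P) (+ m) + (+ k - + m) * q (+ k)      ≡⟨ sym (factor-theorem (a ∷ P) (+ k) (+ m)) ⟩
        eval (a ∷ P) (+ k)                             ≡⟨ vanish k (<⇒≤ m<k) ⟩
        + 0                                            ∎
    ... | inj₁ k-m≡0 = contradiction (+-injective (i-j≡0⇒i≡j (+ k) (+ m) k-m≡0)) (λ { refl → <-irrefl refl m<k })
    ... | inj₂ q≡0   = q≡0

  polynomial-identity : ∀ P Q → (∀ q → eval P (+ q) ≡ eval Q (+ q)) → ∀ x → eval P x ≡ eval Q x
  polynomial-identity P Q agree x = i-j≡0⇒i≡j (eval P x) (eval Q x)
    (trans (sym (eval-⊖ P Q x)) (vanishes-everywhere _ (P ⊖ Q) 0 ≤-refl difference-vanishes x))
    where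
    difference-vanishes : ∀ q → 0 ≤ q → eval (P ⊖ Q) (+ q) ≡ + 0
    difference-vanishes q _ =
      trans (eval-⊖ P Q (+ q)) (trans (cong (λ e → eval P (+ q) - e) (sym (agree q))) (+-inverseʳ (eval P (+ q))))

  monomial : ℕ → Poly
  monomial zero    = + 1 ∷ []
  monomial (suc n) = + 0 ∷ monomial n

  private
    eval-one : ∀ x → + 1 + x * + 0 ≡ + 1
    eval-one = solve-∀

  eval-monomial-ℕ : ∀ n q → eval (monomial n) (+ q) ≡ + (q ℕ.^ n)
  eval-monomial-ℕ zero    q = eval-one (+ q)
  eval-monomial-ℕ (suc n) q =
    trans (+-identityˡ _) (trans (cong (+ q *_) (eval-monomial-ℕ n q)) (sym (pos-* q (q ℕ.^ n))))

  eval-monomial-−1 : ∀ n → eval (monomial n) (- + 1) ≡ negOnePow n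
  eval-monomial-−1 zero    = eval-one (- + 1)
  eval-monomial-−1 (suc n) = trans (+-identityˡ _) (trans (-1*i≡-i _) (cong -_ (eval-monomial-−1 n)))

  negOnePow-square : ∀ n → negOnePow n * negOnePow n ≡ + 1
  negOnePow-square zero    = refl
  negOnePow-square (suc n) = trans (neg*neg (negOnePow n)) (negOnePow-square n)
    where
    neg*neg : ∀ a → (- a) * (- a) ≡ a * a
    neg*neg = solve-∀

module Graphs where

  open import Defs hiding (sym)
  open import Data.Bool using (Bool; true; false; T; _∨_; not)
  open import Data.Bool.Properties using (T-∧; T-≡)
  open import Data.Nat using (ℕ; suc)
  open import Data.Fin using (Fin; punchIn; punchOut)
  open import Data.Fin.Properties
    using (_≟_; punchIn-punchOut; punchOut-punchIn; punchInᵢ≢i; punchOut-cong; punchIn-injective; any?)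
  open import Data.List using (List; []; _∷_; allFin)
  open import Data.List.Membership.Propositional using (_∈_)
  open import Data.List.Membership.Propositional.Properties using (∈-allFin)
  open import Data.List.Relation.Unary.Any using (here; there)
  open import Data.Vec using (Vec; []; _∷_; lookup)
  open import Data.Vec.Relation.Unary.Linked using (Linked; []; [-]; _∷_)
  open import Data.Product using (∃₂; _×_; _,_; proj₁; proj₂)
  open import Data.Sum using (_⊎_; inj₁; inj₂)
  open import Data.Unit using (tt)
  open import Function.Base using (_∘_)
  open import Function.Definitions using (Injective)
  open import Function.Bundles using (_⇔_; mk⇔; Equivalence)
  open import Relation.Binary.PropositionalEquality
    using (_≡_; _≢_; refl; sym; trans; cong)
  open import Relation.Nullary using (¬_; Dec; yes; no; does; contradiction; map′; _×-dec_; _⊎-dec_; ¬?)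
  open import Relation.Nullary.Decidable using (T?; dec-false; does-⇔; ⌊_⌋)
  open import Relation.Unary using (Decidable)

  private variable
    A : Set
    n : ℕ

  Adj : Graph n → Fin n → Fin n → Set
  Adj G u v = adj G u v ≡ true

  Adj-sym : (G : Graph n) {u v : Fin n} → Adj G u v → Adj G v u
  Adj-sym G {u} {v} uv = trans (Graph.sym G v u) uv

  Adj⇒≢ : (G : Graph n) {u v : Fin n} → Adj G u v → u ≢ v
  Adj⇒≢ G {u} uv refl = contradiction (trans (sym uv) (irrefl G u)) λ ()

  adj? : (G : Graph n) (u v : Fin n) → Dec (Adj G u v)
  adj? G u v = map′ (to T-≡) (from T-≡) (T? (adj G u v))
    where open Equivalence

  does≡true : {P : Set} (P? : Dec P) → does P? ≡ true ⇔ P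
  does≡true (yes p) = mk⇔ (λ _ → p) (λ _ → refl)
  does≡true (no ¬p) = mk⇔ (λ ()) (λ p → contradiction p ¬p)

  T-all : (p : A → Bool) (xs : List A) → T (all p xs) ⇔ (∀ {x} → x ∈ xs → T (p x))
  T-all p xs = mk⇔ (all⇒ xs) (⇒all xs)
    where
    all⇒ : ∀ xs → T (all p xs) → ∀ {x} → x ∈ xs → T (p x)
    all⇒ (y ∷ ys) all-p (here refl) = proj₁ (Equivalence.to T-∧ all-p)
    all⇒ (y ∷ ys) all-p (there x∈)  = all⇒ ys (proj₂ (Equivalence.to T-∧ all-p)) x∈
    ⇒all : ∀ xs → (∀ {x} → x ∈ xs → T (p x)) → T (all p xs)
    ⇒all []       _     = tt
    ⇒all (y ∷ ys) all-p = Equivalence.from T-∧ (all-p (here refl) , ⇒all ys (all-p ∘ there))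

  T-allFin : (p : Fin n → Bool) → T (all p (allFin n)) ⇔ (∀ x → T (p x))
  T-allFin {n} p = mk⇔ (λ t x → Equivalence.to (T-all p (allFin n)) t (∈-allFin x))
                       (λ ps → Equivalence.from (T-all p (allFin n)) (λ {x} _ → ps x))

  T-allPairs : {P : Fin n → Fin n → Set} (p : Fin n → Fin n → Bool) → (∀ u v → T (p u v) ⇔ P u v) →
               T (all (λ u → all (p u) (allFin n)) (allFin n)) ⇔ (∀ u v → P u v)
  T-allPairs p T-p = mk⇔
    (λ t u v → Equivalence.to (T-p u v) (Equivalence.to (T-allFin _) (Equivalence.to (T-allFin _) t u) v))
    (λ ps → Equivalence.from (T-allFin _) (λ u → Equivalence.from (T-allFin _) (λ v → Equivalence.from (T-p u v) (ps u v))))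

  Proper : {q : ℕ} → Graph n → Vec (Fin q) n → Set
  Proper G c = ∀ u v → Adj G u v → lookup c u ≢ lookup c v

  -- Built on T? (isProper G c), so that does (proper? G c) is definitionally isProper G c and
  -- numColourings is a count #[ proper? G ]; likewise for hamiltonian? and HP.
  proper? : {q : ℕ} (G : Graph n) → Decidable (Proper {q = q} G)
  proper? G c = map′ (Equivalence.to (T-allPairs _ T-test)) (Equivalence.from (T-allPairs _ T-test)) (T? (isProper G c))
    where
    T-test : ∀ u v → T (not (adj G u v) ∨ not ⌊ lookup c u ≟ lookup c v ⌋) ⇔ (Adj G u v → lookup c u ≢ lookup c v)
    T-test u v with adj G u v | lookup c u ≟ lookup c v
    ... | false | _      = mk⇔ (λ _ ()) (λ _ → tt)
    ... | true  | no ≢   = mk⇔ (λ _ _ → ≢) (λ _ → tt)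
    ... | true  | yes ≡c = mk⇔ (λ ()) (λ f → f refl ≡c)

  Consecutive : Graph n → ∀ {k} → Vec (Fin n) k → Set
  Consecutive G = Linked (Adj G)

  T-consecAdj : (G : Graph n) {k : ℕ} (w : Vec (Fin n) k) → T (consecAdj G w) ⇔ Consecutive G w
  T-consecAdj {n} G w = mk⇔ (consecAdj⇒ w) ⇒consecAdj
    where
    consecAdj⇒ : ∀ {k} (w : Vec (Fin n) k) → T (consecAdj G w) → Consecutive G w
    consecAdj⇒ []          _ = []
    consecAdj⇒ (x ∷ [])    _ = [-]
    consecAdj⇒ (x ∷ y ∷ w) t =
      Equivalence.to T-≡ (proj₁ (Equivalence.to T-∧ t)) ∷ consecAdj⇒ (y ∷ w) (proj₂ (Equivalence.to T-∧ t))
    ⇒consecAdj : ∀ {k} {w : Vec (Fin n) k} → Consecutive G w → T (consecAdj G w)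
    ⇒consecAdj {w = []}        []          = tt
    ⇒consecAdj {w = x ∷ []}    [-]         = tt
    ⇒consecAdj {w = x ∷ y ∷ w} (xy ∷ rest) = Equivalence.from T-∧ (Equivalence.from T-≡ xy , ⇒consecAdj rest)

  HamiltonianPath : Graph n → Vec (Fin n) n → Set
  HamiltonianPath G w = Injective _≡_ _≡_ (lookup w) × Consecutive G w

  hamiltonian? : (G : Graph n) → Decidable (HamiltonianPath G)
  hamiltonian? G w = map′
    (λ t → let (inj , cons) = Equivalence.to T-∧ t in
           (λ {i} {j} → Equivalence.to (T-allPairs _ T-test) inj i j) , Equivalence.to (T-consecAdj G w) cons)
    (λ (inj , cons) → Equivalence.from T-∧
           (Equivalence.from (T-allPairs _ T-test) (λ i j → inj) , Equivalence.from (T-consecAdj G w) cons))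
    (T? (isHamPath G w))
    where
    T-test : ∀ i j → T (⌊ i ≟ j ⌋ ∨ not ⌊ lookup w i ≟ lookup w j ⌋) ⇔ (lookup w i ≡ lookup w j → i ≡ j)
    T-test i j with i ≟ j | lookup w i ≟ lookup w j
    ... | yes i≡j | _        = mk⇔ (λ _ _ → i≡j) (λ _ → tt)
    ... | no _    | no wi≢wj = mk⇔ (λ _ wi≡wj → contradiction wi≡wj wi≢wj) (λ _ → tt)
    ... | no i≢j  | yes wi≡wj = mk⇔ (λ ()) (λ f → i≢j (f wi≡wj))

  module _ (R : Fin n → Fin n → Set) (R? : ∀ u v → Dec (R u v))
           (R-sym : ∀ {u v} → R u v → R v u) (R-irrefl : ∀ {v} → ¬ R v v) where

    fromRelation : Graph n
    fromRelation = record
      { adj    = λ u v → does (R? u v)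
      ; sym    = λ u v → does-⇔ (mk⇔ R-sym R-sym) (R? u v) (R? v u)
      ; irrefl = λ v → dec-false (R? v v) R-irrefl
      }

    Adj-fromRelation : ∀ {u v} → Adj fromRelation u v ⇔ R u v
    Adj-fromRelation {u} {v} = does≡true (R? u v)

  Pair : Fin n → Fin n → Fin n → Fin n → Set
  Pair a b u v = (u ≡ a × v ≡ b) ⊎ (u ≡ b × v ≡ a)

  Pair-swap : {a b u v : Fin n} → Pair a b u v → Pair a b v u
  Pair-swap (inj₁ (u≡a , v≡b)) = inj₂ (v≡b , u≡a)
  Pair-swap (inj₂ (u≡b , v≡a)) = inj₁ (v≡a , u≡b)

  pair? : (a b u v : Fin n) → Dec (Pair a b u v)
  pair? a b u v = ((u ≟ a) ×-dec (v ≟ b)) ⊎-dec ((u ≟ b) ×-dec (v ≟ a))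

  module _ (G : Graph n) (a b : Fin n) where

    private
      Kept : Fin n → Fin n → Set
      Kept u v = Adj G u v × ¬ Pair a b u v

      kept? : ∀ u v → Dec (Kept u v)
      kept? u v = adj? G u v ×-dec ¬? (pair? a b u v)

      Kept-sym : ∀ {u v} → Kept u v → Kept v u
      Kept-sym (uv , ¬ab) = Adj-sym G uv , ¬ab ∘ Pair-swap

      Kept-irrefl : ∀ {v} → ¬ Kept v v
      Kept-irrefl (vv , _) = Adj⇒≢ G vv refl

    delete : Graph n
    delete = fromRelation Kept kept? Kept-sym Kept-irrefl

    Adj-delete : ∀ {u v} → Adj delete u v ⇔ (Adj G u v × ¬ Pair a b u v)
    Adj-delete = Adj-fromRelation Kept kept? Kept-sym Kept-irrefl

  module _ {m : ℕ} (H : Graph n) (π : Fin n → Fin m) where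

    private
      Image : Fin m → Fin m → Set
      Image x y = x ≢ y × ∃₂ λ u v → π u ≡ x × π v ≡ y × Adj H u v

      image? : ∀ x y → Dec (Image x y)
      image? x y = ¬? (x ≟ y) ×-dec any? λ u → any? λ v → (π u ≟ x) ×-dec (π v ≟ y) ×-dec adj? H u v

      Image-sym : ∀ {x y} → Image x y → Image y x
      Image-sym (x≢y , u , v , πu , πv , uv) = x≢y ∘ sym , v , u , πv , πu , Adj-sym H uv

      Image-irrefl : ∀ {x} → ¬ Image x x
      Image-irrefl (x≢x , _) = x≢x refl

    quotient : Graph m
    quotient = fromRelation Image image? Image-sym Image-irrefl

    Adj-quotient : ∀ {x y} → Adj quotient x y ⇔ (x ≢ y × ∃₂ λ u v → π u ≡ x × π v ≡ y × Adj H u v)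
    Adj-quotient = Adj-fromRelation Image image? Image-sym Image-irrefl

  module Collapse {m : ℕ} {a b : Fin (suc m)} (a≢b : a ≢ b) where

    ι : Fin m → Fin (suc m)
    ι = punchIn b

    π : Fin (suc m) → Fin m
    π v with b ≟ v
    ... | yes _   = punchOut (a≢b ∘ sym)
    ... | no b≢v  = punchOut b≢v

    ι∘π : ∀ v → v ≢ b → ι (π v) ≡ v
    ι∘π v v≢b with b ≟ v
    ... | yes b≡v = contradiction (sym b≡v) v≢b
    ... | no b≢v  = punchIn-punchOut b≢v

    ι∘π-b : ι (π b) ≡ a
    ι∘π-b with b ≟ b
    ... | yes _   = punchIn-punchOut (a≢b ∘ sym)
    ... | no b≢b  = contradiction refl b≢b

    π∘ι : ∀ x → π (ι x) ≡ x
    π∘ι x with b ≟ ι x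
    ... | yes b≡ιx = contradiction (sym b≡ιx) (punchInᵢ≢i b x)
    ... | no _     = trans (punchOut-cong b refl) (punchOut-punchIn b)

    ι∘π-invariant : {A : Set} (f : Fin (suc m) → A) → f a ≡ f b → ∀ v → f (ι (π v)) ≡ f v
    ι∘π-invariant f fa≡fb v with v ≟ b
    ... | yes refl = trans (cong f ι∘π-b) fa≡fb
    ... | no v≢b   = cong f (ι∘π v v≢b)

    π-a≡π-b : π a ≡ π b
    π-a≡π-b = punchIn-injective b _ _ (trans (ι∘π a a≢b) (sym ι∘π-b))

    π-injective : ∀ {u v} → π u ≡ π v → u ≡ v ⊎ Pair a b u v
    π-injective {u} {v} πu≡πv with u ≟ b | v ≟ b
    ... | yes refl | yes refl = inj₁ refl
    ... | yes refl | no v≢b   = inj₂ (inj₂ (refl , trans (sym (ι∘π v v≢b)) (trans (cong ι (sym πu≡πv)) ι∘π-b)))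
    ... | no u≢b   | yes refl = inj₂ (inj₁ (trans (sym (ι∘π u u≢b)) (trans (cong ι πu≡πv) ι∘π-b) , refl))
    ... | no u≢b   | no v≢b   = inj₁ (trans (sym (ι∘π u u≢b)) (trans (cong ι πu≡πv) (ι∘π v v≢b)))

  contract : ∀ {m} (G : Graph (suc m)) (a b : Fin (suc m)) → a ≢ b → Graph m
  contract G a b a≢b = quotient (delete G a b) (Collapse.π a≢b)

module Orientations where

  open import Defs hiding (sym)
  open Counting
  open Graphs
  open import Data.Bool using (Bool; true; false; if_then_else_)
  open import Data.Nat using (ℕ; suc; _+_; _≤_; _<_; _<?_; z≤n; s≤s)
  open import Data.Nat.Properties
    using (<-irrefl; <-asym; <-trans; <-cmp; ≤-refl; ≤-trans; ≤-reflexive; +-mono-≤; +-monoˡ-≤; +-suc; m≤n+m)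
  open import Data.Fin using (Fin; toℕ; fromℕ<)
  open import Data.Fin.Properties using (_≟_; all?; toℕ-fromℕ<)
  open import Data.List using ([]; _∷_; allFin)
  open import Data.List.Properties using (length-tabulate)
  open import Data.List.Membership.Propositional using (lose)
  open import Data.List.Membership.Propositional.Properties using (∈-allFin)
  open import Data.List.Relation.Unary.Any using (here; there; satisfied; any?)
  open import Data.List.Relation.Unary.AllPairs using ([]; _∷_)
  open import Data.List.Relation.Unary.All using ([]; _∷_)
  open import Data.Vec using (Vec; lookup; tabulate)
  open import Data.Vec.Properties using (lookup∘tabulate)
  open import Data.Vec.Relation.Binary.Pointwise.Extensional using (ext; Pointwise-≡⇒≡)
  open import Data.Product using (∃; _×_; _,_; proj₁; proj₂)
  open import Data.Sum using (_⊎_; inj₁; inj₂; [_,_]′)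
  open import Data.Unit using (tt)
  open import Function.Base using (_∘_)
  open import Function.Bundles using (_⇔_; mk⇔; Equivalence)
  open import Relation.Binary.Definitions using (tri<; tri≈; tri>)
  open import Relation.Binary.PropositionalEquality
    using (_≡_; _≢_; refl; sym; trans; cong; subst; subst₂)
  open import Relation.Nullary using (¬_; Dec; yes; no; does; contradiction; map′; _×-dec_; _⊎-dec_; _→-dec_)
  open import Relation.Unary using (Decidable)

  private variable
    n : ℕ

  Orientation : ℕ → Set
  Orientation n = Vec (Vec Bool n) n

  arc : Orientation n → Fin n → Fin n → Bool
  arc o u v = lookup (lookup o u) v

  record Arc (o : Orientation n) (u v : Fin n) : Set where
    constructor mkArc
    field isArc : arc o u v ≡ true

  orientations : ∀ n → Enumeration (Orientation n)
  orientations n = vecEnumeration (vecEnumeration booleans n) n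
    where
    booleans : Enumeration Bool
    booleans = record
      { elements = true ∷ false ∷ []
      ; unique   = ((λ ()) ∷ []) ∷ [] ∷ []
      ; complete = λ { true → here refl ; false → there (here refl) }
      }

  orientation-ext : {o o′ : Orientation n} → (∀ u v → Arc o u v ⇔ Arc o′ u v) → o ≡ o′
  orientation-ext same = Pointwise-≡⇒≡ (ext λ u → Pointwise-≡⇒≡ (ext λ v → bool-ext (same u v)))
    where
    bool-ext : ∀ {o o′ : Orientation n} {u v} → (Arc o u v ⇔ Arc o′ u v) → arc o u v ≡ arc o′ u v
    bool-ext {o = o} {o′} {u} {v} o⇔o′ with arc o u v in ouv | arc o′ u v in o′uv
    ... | true  | true  = refl
    ... | false | false = refl
    ... | true  | false = sym (trans (sym o′uv) (Arc.isArc (Equivalence.to o⇔o′ (mkArc ouv))))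
    ... | false | true  = trans (sym ouv) (Arc.isArc (Equivalence.from o⇔o′ (mkArc o′uv)))

  orientationOf : {R : Fin n → Fin n → Set} → (∀ u v → Dec (R u v)) → Orientation n
  orientationOf R? = tabulate λ u → tabulate λ v → does (R? u v)

  Arc-orientationOf : {R : Fin n → Fin n → Set} (R? : ∀ u v → Dec (R u v)) →
                      ∀ {u v} → Arc (orientationOf R?) u v ⇔ R u v
  Arc-orientationOf R? {u} {v} = mk⇔ (Equivalence.to (does≡true (R? u v)) ∘ subst (_≡ true) arc≡ ∘ Arc.isArc)
                                    (mkArc ∘ subst (_≡ true) (sym arc≡) ∘ Equivalence.from (does≡true (R? u v)))
    where
    arc≡ : arc (orientationOf R?) u v ≡ does (R? u v)
    arc≡ = trans (cong (λ row → lookup row v) (lookup∘tabulate _ u)) (lookup∘tabulate _ v)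

  arc? : (o : Orientation n) (u v : Fin n) → Dec (Arc o u v)
  arc? o u v = map′ mkArc Arc.isArc (arc o u v Data.Bool.≟ true)
    where import Data.Bool

  Ranks : Orientation n → (Fin n → ℕ) → Set
  Ranks o r = ∀ {u v} → Arc o u v → r u < r v

  Acyclic : Orientation n → Set
  Acyclic o = ∃ (Ranks o)

  Acyclic⇒¬Arc : {o : Orientation n} → Acyclic o → ∀ {u v} → Arc o u v → ¬ Arc o v u
  Acyclic⇒¬Arc (r , ranks) uv vu = <-irrefl refl (<-trans (ranks uv) (ranks vu))

  module Normalise (r : Fin n → ℕ) where

    normalise : Fin n → ℕ
    normalise v = #[ (λ u → r u <? r v) ] allFin n

    normalise-mono : ∀ {u v} → r u < r v → normalise u < normalise v
    normalise-mono {u} {v} ru<rv =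
      #-mono-< (λ w → r w <? r u) (λ w → r w <? r v) (λ rw<ru → <-trans rw<ru ru<rv)
               (∈-allFin u) ru<rv (<-irrefl refl)

    normalise<n : ∀ v → normalise v < n
    normalise<n v = subst (normalise v <_) n-elements
      (#-mono-< (λ u → r u <? r v) (λ _ → yes tt) _ (∈-allFin v) tt (<-irrefl refl))
      where
      n-elements : #[ (λ (_ : Fin n) → yes tt) ] allFin n ≡ n
      n-elements = trans (#-all (λ _ → yes tt) (allFin n) (λ _ → tt)) (length-tabulate (λ x → x))

    rankVector : Vec (Fin n) n
    rankVector = tabulate λ v → fromℕ< (normalise<n v)

    toℕ-rankVector : ∀ v → toℕ (lookup rankVector v) ≡ normalise v
    toℕ-rankVector v = trans (cong toℕ (lookup∘tabulate _ v)) (toℕ-fromℕ< (normalise<n v))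

  -- Acyclicity is decided by searching the finitely many rank vectors with entries below n.
  acyclic? : Decidable (Acyclic {n})
  acyclic? {n} o = map′ (λ found → let (R , ranks) = satisfied {P = Ranks o ∘ vectorRanks} found in vectorRanks R , ranks)
                        (λ (r , ranks) → lose (complete (vecEnumeration (finEnumeration n) n) (rankVector r))
                                              (normalised-ranks r ranks))
                        (any? (ranks? ∘ vectorRanks) (elements (vecEnumeration (finEnumeration n) n)))
    where
    open Normalise
    vectorRanks : Vec (Fin n) n → Fin n → ℕ
    vectorRanks R = toℕ ∘ lookup R
    ranks? : (r : Fin n → ℕ) → Dec (Ranks o r)
    ranks? r = map′ (λ ranks {u} {v} → ranks u v) (λ ranks u v → ranks {u} {v})
                    (all? λ u → all? λ v → arc? o u v →-dec r u <? r v)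
    normalised-ranks : ∀ r → Ranks o r → Ranks o (toℕ ∘ lookup (rankVector r))
    normalised-ranks r ranks uv =
      subst₂ _<_ (sym (toℕ-rankVector r _)) (sym (toℕ-rankVector r _)) (normalise-mono r (ranks uv))

  Acyclic-⊆ : {o o′ : Orientation n} → (∀ {u v} → Arc o u v → Arc o′ u v) → Acyclic o′ → Acyclic o
  Acyclic-⊆ o⊆o′ (r , ranks) = r , ranks ∘ o⊆o′

  withArc : Orientation n → Fin n → Fin n → Orientation n
  withArc o x y = orientationOf λ u v → arc? o u v ⊎-dec ((u ≟ x) ×-dec (v ≟ y))

  Arc-withArc : (o : Orientation n) (x y : Fin n) → ∀ {u v} → Arc (withArc o x y) u v ⇔ (Arc o u v ⊎ (u ≡ x × v ≡ y))
  Arc-withArc o x y = Arc-orientationOf λ u v → arc? o u v ⊎-dec ((u ≟ x) ×-dec (v ≟ y))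

  withArc⁺ : ∀ (o : Orientation n) x y {u v} → Arc o u v ⊎ (u ≡ x × v ≡ y) → Arc (withArc o x y) u v
  withArc⁺ o x y = Equivalence.from (Arc-withArc o x y)

  withArc⁻ : ∀ (o : Orientation n) x y {u v} → Arc (withArc o x y) u v → Arc o u v ⊎ (u ≡ x × v ≡ y)
  withArc⁻ o x y = Equivalence.to (Arc-withArc o x y)

  -- Doubling the ranks leaves room to lift y just above x.
  Acyclic-withArc : {o : Orientation n} {r : Fin n → ℕ} → Ranks o r → ∀ {x y} → x ≢ y → r x ≤ r y →
                    Acyclic (withArc o x y)
  Acyclic-withArc {o = o} {r} ranks {x} {y} x≢y rx≤ry = ρ , ρ-ranks ∘ withArc⁻ o x y
    where
    lift : Fin _ → ℕ
    lift w = if does (w ≟ y) then 1 else 0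
    lift≤1 : ∀ w → lift w ≤ 1
    lift≤1 w with w ≟ y
    ... | yes _ = ≤-refl
    ... | no _  = z≤n
    ρ : Fin _ → ℕ
    ρ w = lift w + (r w + r w)
    ρ-ranks : ∀ {u v} → Arc o u v ⊎ (u ≡ x × v ≡ y) → ρ u < ρ v
    ρ-ranks {u} {v} (inj₁ uv) =
      ≤-trans (s≤s (+-monoˡ-≤ (r u + r u) (lift≤1 u)))
     (≤-trans (≤-reflexive (cong suc (sym (+-suc (r u) (r u)))))
     (≤-trans (+-mono-≤ (ranks uv) (ranks uv)) (m≤n+m (r v + r v) (lift v))))
    ρ-ranks (inj₂ (refl , refl)) with x ≟ y | y ≟ y
    ... | yes x≡y | _      = contradiction x≡y x≢y
    ... | no _    | no y≢y = contradiction refl y≢y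
    ... | no _    | yes _  = s≤s (+-mono-≤ rx≤ry rx≤ry)

  -- That no edge is oriented both ways follows from acyclicity.
  record IsAcyclicOrientation (G : Graph n) (o : Orientation n) : Set where
    field
      arc⇒adj : ∀ u v → Arc o u v → Adj G u v
      adj⇒arc : ∀ u v → Adj G u v → Arc o u v ⊎ Arc o v u
      acyclic : Acyclic o
  open IsAcyclicOrientation public

  acyclicOrientation? : (G : Graph n) → Decidable (IsAcyclicOrientation G)
  acyclicOrientation? G o = map′ (λ (a , b , c) → record { arc⇒adj = a ; adj⇒arc = b ; acyclic = c })
    (λ ao → arc⇒adj ao , adj⇒arc ao , acyclic ao)
    ((all? λ u → all? λ v → arc? o u v →-dec adj? G u v) ×-dec
     (all? λ u → all? λ v → adj? G u v →-dec (arc? o u v ⊎-dec arc? o v u)) ×-dec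
     acyclic? o)

  AO : Graph n → ℕ
  AO {n} G = #[ acyclicOrientation? G ] elements (orientations n)

  byRank : Graph n → (Fin n → ℕ) → Orientation n
  byRank G r = orientationOf λ u v → adj? G u v ×-dec r u <? r v

  Arc-byRank : (G : Graph n) (r : Fin n → ℕ) → ∀ {u v} → Arc (byRank G r) u v ⇔ (Adj G u v × r u < r v)
  Arc-byRank G r = Arc-orientationOf λ u v → adj? G u v ×-dec r u <? r v

  byRank-acyclicOrientation : (G : Graph n) (r : Fin n → ℕ) → (∀ {u v} → Adj G u v → r u ≢ r v) →
                              IsAcyclicOrientation G (byRank G r)
  byRank-acyclicOrientation G r r-separates = record
    { arc⇒adj = λ u v uv → proj₁ (Equivalence.to (Arc-byRank G r) uv)
    ; adj⇒arc = adj⇒arc′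
    ; acyclic = r , proj₂ ∘ Equivalence.to (Arc-byRank G r)
    }
    where
    adj⇒arc′ : ∀ u v → Adj G u v → Arc (byRank G r) u v ⊎ Arc (byRank G r) v u
    adj⇒arc′ u v uv with <-cmp (r u) (r v)
    ... | tri< ru<rv _ _ = inj₁ (Equivalence.from (Arc-byRank G r) (uv , ru<rv))
    ... | tri≈ _ ru≡rv _ = contradiction ru≡rv (r-separates uv)
    ... | tri> _ _ rv<ru = inj₂ (Equivalence.from (Arc-byRank G r) (Adj-sym G uv , rv<ru))

  byRank-ranking : {G : Graph n} {o : Orientation n} {r : Fin n → ℕ} →
                   IsAcyclicOrientation G o → Ranks o r → byRank G r ≡ o
  byRank-ranking {G = G} {o} {r} ao ranks = orientation-ext λ u v → mk⇔
    (λ uv → let (adj-uv , ru<rv) = Equivalence.to (Arc-byRank G r) uv in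
            [ (λ ouv → ouv) , (λ ovu → contradiction (ranks ovu) (<-asym ru<rv)) ]′ (adj⇒arc ao u v adj-uv))
    (λ ouv → Equivalence.from (Arc-byRank G r) (arc⇒adj ao u v ouv , ranks ouv))

module DeletionContraction where

  open import Defs hiding (sym)
  open Counting
  open Graphs
  open Orientations
  open import Data.Nat using (ℕ; suc; _+_; _<_; _<?_; s≤s; z<s)
  open import Data.Nat.Properties
    using (+-comm; <-trans; <-asym; ≤-total; ≤-reflexive; <-≤-trans; +-monoʳ-<; m≤m+n; m<m+n)
  open import Data.Fin using (Fin)
  open import Data.Fin.Properties using (_≟_; any?)
  open import Data.Vec using (Vec; lookup; tabulate)
  open import Data.Vec.Properties using (lookup∘tabulate)
  open import Data.Vec.Relation.Binary.Pointwise.Extensional using (ext; Pointwise-≡⇒≡)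
  open import Data.Product using (∃; ∃₂; _×_; _,_; proj₁; proj₂)
  open import Data.Sum using (_⊎_; inj₁; inj₂; [_,_]′)
  import Data.Sum
  open import Data.Empty using (⊥; ⊥-elim)
  open import Function.Base using (_∘_)
  open import Function.Bundles using (_⇔_; mk⇔; Equivalence)
  open import Relation.Binary.PropositionalEquality
    using (_≡_; _≢_; refl; sym; trans; cong; cong₂; subst₂; module ≡-Reasoning)
  open import Relation.Nullary using (¬_; Dec; yes; no; contradiction; _×-dec_; _⊎-dec_; ¬?)
  open import Relation.Unary.Properties using (_∩?_; _∪?_; ∁?)

  private variable
    n : ℕ

  numColourings≡ : (G : Graph n) (q : ℕ) → numColourings G q ≡ #[ proper? G ] elements (finVectors n q)
  numColourings≡ {n} G q = cong (count (isProper G)) (allVecs≡finVectors n q)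

  pullback : ∀ {m q} → (Fin m → Fin n) → Vec (Fin q) n → Vec (Fin q) m
  pullback f c = tabulate (lookup c ∘ f)

  lookup-pullback : ∀ {m q} (f : Fin m → Fin n) (c : Vec (Fin q) n) x → lookup (pullback f c) x ≡ lookup c (f x)
  lookup-pullback f c = lookup∘tabulate (lookup c ∘ f)

  module AlongEdge {m : ℕ} (G : Graph (suc m)) {a b : Fin (suc m)} (a≢b : a ≢ b) (ab : Adj G a b) where

    open Collapse a≢b

    D : Graph (suc m)
    D = delete G a b

    C : Graph m
    C = contract G a b a≢b

    Adj-D : ∀ {u v} → Adj D u v ⇔ (Adj G u v × ¬ Pair a b u v)
    Adj-D = Adj-delete G a b

    Adj-C : ∀ {x y} → Adj C x y ⇔ (x ≢ y × ∃₂ λ u v → π u ≡ x × π v ≡ y × Adj D u v)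
    Adj-C = Adj-quotient D π

    Adj-D⇒Adj-G : ∀ {u v} → Adj D u v → Adj G u v
    Adj-D⇒Adj-G = proj₁ ∘ Equivalence.to Adj-D

    Adj-G⇒Adj-D : ∀ {u v} → Adj G u v → ¬ Pair a b u v → Adj D u v
    Adj-G⇒Adj-D uv ¬ab = Equivalence.from Adj-D (uv , ¬ab)

    Adj-D⇒¬Pair : ∀ {u v} → Adj D u v → ¬ Pair a b u v
    Adj-D⇒¬Pair = proj₂ ∘ Equivalence.to Adj-D

    Adj-D⇒Adj-C : ∀ {u v} → Adj D u v → Adj C (π u) (π v)
    Adj-D⇒Adj-C {u} {v} uv = Equivalence.from Adj-C (πu≢πv , u , v , refl , refl , uv)
      where
      πu≢πv : π u ≢ π v
      πu≢πv πu≡πv with π-injective πu≡πv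
      ... | inj₁ u≡v = Adj⇒≢ D uv u≡v
      ... | inj₂ ab′ = Adj-D⇒¬Pair uv ab′

    Pair-adj : ∀ {u v} → Pair a b u v → Adj G u v
    Pair-adj (inj₁ (refl , refl)) = ab
    Pair-adj (inj₂ (refl , refl)) = Adj-sym G ab

    EqualOnEnds : ∀ {q} → Vec (Fin q) (suc m) → Set
    EqualOnEnds c = lookup c a ≡ lookup c b

    proper-D-apart⇔proper-G : ∀ {q} (c : Vec (Fin q) (suc m)) → (Proper D c × ¬ EqualOnEnds c) ⇔ Proper G c
    proper-D-apart⇔proper-G c = mk⇔
      (λ (proper , ca≢cb) u v uv → case (pair? a b u v) proper ca≢cb uv)
      (λ proper → (λ u v uv → proper u v (Adj-D⇒Adj-G uv)) , proper a b ab)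
      where
      case : ∀ {u v} → Dec (Pair a b u v) → Proper D c → ¬ EqualOnEnds c → Adj G u v → lookup c u ≢ lookup c v
      case (yes (inj₁ (refl , refl))) _ ca≢cb _ = ca≢cb
      case (yes (inj₂ (refl , refl))) _ ca≢cb _ = ca≢cb ∘ sym
      case {u} {v} (no ¬ab) proper _ uv = proper u v (Adj-G⇒Adj-D uv ¬ab)

    proper-C⇒proper-D : ∀ {q} (c : Vec (Fin q) m) → Proper C c → Proper D (pullback π c) × EqualOnEnds (pullback π c)
    proper-C⇒proper-D c proper =
      (λ u v uv → subst₂ _≢_ (sym (lookup-pullback π c u)) (sym (lookup-pullback π c v))
                             (proper (π u) (π v) (Adj-D⇒Adj-C uv))) ,
      trans (lookup-pullback π c a) (trans (cong (lookup c) π-a≡π-b) (sym (lookup-pullback π c b)))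

    proper-D⇒proper-C : ∀ {q} (c : Vec (Fin q) (suc m)) → Proper D c × EqualOnEnds c → Proper C (pullback ι c)
    proper-D⇒proper-C c (proper , same) x y xy with Equivalence.to Adj-C xy
    ... | _ , u , v , refl , refl , uv =
      subst₂ _≢_ (sym (trans (lookup-pullback ι c (π u)) (ι∘π-invariant (lookup c) same u)))
                 (sym (trans (lookup-pullback ι c (π v)) (ι∘π-invariant (lookup c) same v)))
                 (proper u v uv)

    colour-deletion-contraction : ∀ q → numColourings D q ≡ numColourings G q + numColourings C q
    colour-deletion-contraction q = begin
      numColourings D q
        ≡⟨ numColourings≡ D q ⟩
      #[ proper? D ] cs
        ≡⟨ #-split (proper? D) same? cs ⟩
      #[ proper? D ∩? same? ] cs + #[ proper? D ∩? ∁? same? ] cs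
        ≡⟨ cong₂ _+_ contracted deleted ⟩
      #[ proper? C ] elements (finVectors m q) + #[ proper? G ] cs
        ≡⟨ +-comm (#[ proper? C ] elements (finVectors m q)) (#[ proper? G ] cs) ⟩
      #[ proper? G ] cs + #[ proper? C ] elements (finVectors m q)
        ≡⟨ sym (cong₂ _+_ (numColourings≡ G q) (numColourings≡ C q)) ⟩
      numColourings G q + numColourings C q ∎
      where
      open ≡-Reasoning
      cs = elements (finVectors (suc m) q)
      same? : (c : Vec (Fin q) (suc m)) → Dec (EqualOnEnds c)
      same? c = lookup c a ≟ lookup c b
      deleted : #[ proper? D ∩? ∁? same? ] cs ≡ #[ proper? G ] cs
      deleted = #-cong (proper? D ∩? ∁? same?) (proper? G) proper-D-apart⇔proper-G cs
      contracted : #[ proper? D ∩? same? ] cs ≡ #[ proper? C ] elements (finVectors m q)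
      contracted = #-bijection (proper? D ∩? same?) (proper? C) (finVectors (suc m) q) (finVectors m q)
        (pullback ι) (pullback π) (λ {c} → proper-D⇒proper-C c) (λ {c} → proper-C⇒proper-D c)
        (λ {c} (_ , same) → Pointwise-≡⇒≡ (ext λ u → trans (lookup-pullback π (pullback ι c) u)
                                            (trans (lookup-pullback ι c (π u)) (ι∘π-invariant (lookup c) same u))))
        (λ {c} _ → Pointwise-≡⇒≡ (ext λ x → trans (lookup-pullback ι (pullback π c) x)
                                             (trans (lookup-pullback π c (ι x)) (cong (lookup c) (π∘ι x)))))

    Pair-cases : ∀ {x y u v} → Pair a b x y → Pair a b u v → (u ≡ x × v ≡ y) ⊎ (u ≡ y × v ≡ x)
    Pair-cases (inj₁ (refl , refl)) (inj₁ (refl , refl)) = inj₁ (refl , refl)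
    Pair-cases (inj₁ (refl , refl)) (inj₂ (refl , refl)) = inj₂ (refl , refl)
    Pair-cases (inj₂ (refl , refl)) (inj₁ (refl , refl)) = inj₂ (refl , refl)
    Pair-cases (inj₂ (refl , refl)) (inj₂ (refl , refl)) = inj₁ (refl , refl)

    withoutPair : Orientation (suc m) → Orientation (suc m)
    withoutPair o = orientationOf λ u v → arc? o u v ×-dec ¬? (pair? a b u v)

    Arc-withoutPair : ∀ o {u v} → Arc (withoutPair o) u v ⇔ (Arc o u v × ¬ Pair a b u v)
    Arc-withoutPair o = Arc-orientationOf λ u v → arc? o u v ×-dec ¬? (pair? a b u v)

    withoutPair⁻ : ∀ o {u v} → Arc (withoutPair o) u v → Arc o u v × ¬ Pair a b u v
    withoutPair⁻ o = Equivalence.to (Arc-withoutPair o)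

    withoutPair⁺ : ∀ o {u v} → Arc o u v → ¬ Pair a b u v → Arc (withoutPair o) u v
    withoutPair⁺ o uv ¬ab = Equivalence.from (Arc-withoutPair o) (uv , ¬ab)

    AO-D⇒¬Pair : ∀ {o} → IsAcyclicOrientation D o → ∀ {u v} → Arc o u v → ¬ Pair a b u v
    AO-D⇒¬Pair ao {u} {v} uv = Adj-D⇒¬Pair (arc⇒adj ao u v uv)

    ExtendsBy : Fin (suc m) → Fin (suc m) → Orientation (suc m) → Set
    ExtendsBy x y o = IsAcyclicOrientation D o × Acyclic (withArc o x y)

    extendsBy? : ∀ x y o → Dec (ExtendsBy x y o)
    extendsBy? x y o = acyclicOrientation? D o ×-dec acyclic? (withArc o x y)

    module Deletion {x y : Fin (suc m)} (xy : Pair a b x y) where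

      withoutPair-extends : ∀ {o} → IsAcyclicOrientation G o × Arc o x y → ExtendsBy x y (withoutPair o)
      withoutPair-extends {o} (ao , oxy) = ao-D , Acyclic-⊆ ⊆o (acyclic ao)
        where
        ao-D : IsAcyclicOrientation D (withoutPair o)
        ao-D = record
          { arc⇒adj = λ u v uv → let (ouv , ¬ab) = withoutPair⁻ o uv in Adj-G⇒Adj-D (arc⇒adj ao u v ouv) ¬ab
          ; adj⇒arc = λ u v uv → Data.Sum.map (λ ouv → withoutPair⁺ o ouv (Adj-D⇒¬Pair uv))
                                               (λ ovu → withoutPair⁺ o ovu (Adj-D⇒¬Pair (Adj-sym D uv)))
                                               (adj⇒arc ao u v (Adj-D⇒Adj-G uv))
          ; acyclic = Acyclic-⊆ (proj₁ ∘ withoutPair⁻ o) (acyclic ao)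
          }
        ⊆o : ∀ {u v} → Arc (withArc (withoutPair o) x y) u v → Arc o u v
        ⊆o uv with withArc⁻ (withoutPair o) x y uv
        ... | inj₁ uv′           = proj₁ (withoutPair⁻ o uv′)
        ... | inj₂ (refl , refl) = oxy

      withArc-acyclicOrientation : ∀ {o} → ExtendsBy x y o → IsAcyclicOrientation G (withArc o x y) × Arc (withArc o x y) x y
      withArc-acyclicOrientation {o} (ao , acyclic-xy) = ao-G , withArc⁺ o x y (inj₂ (refl , refl))
        where
        adj⇒arc′ : ∀ u v → Adj G u v → Dec (Pair a b u v) → Arc (withArc o x y) u v ⊎ Arc (withArc o x y) v u
        adj⇒arc′ u v uv (yes uv-ab) with Pair-cases xy uv-ab
        ... | inj₁ (refl , refl) = inj₁ (withArc⁺ o x y (inj₂ (refl , refl)))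
        ... | inj₂ (refl , refl) = inj₂ (withArc⁺ o x y (inj₂ (refl , refl)))
        adj⇒arc′ u v uv (no ¬ab) =
          Data.Sum.map (withArc⁺ o x y ∘ inj₁) (withArc⁺ o x y ∘ inj₁) (adj⇒arc ao u v (Adj-G⇒Adj-D uv ¬ab))
        ao-G : IsAcyclicOrientation G (withArc o x y)
        ao-G = record
          { arc⇒adj = λ u v uv → [ Adj-D⇒Adj-G ∘ arc⇒adj ao u v , (λ { (refl , refl) → Pair-adj xy }) ]′
                                   (withArc⁻ o x y uv)
          ; adj⇒arc = λ u v uv → adj⇒arc′ u v uv (pair? a b u v)
          ; acyclic = acyclic-xy
          }

      withArc∘withoutPair : ∀ {o} → IsAcyclicOrientation G o × Arc o x y → withArc (withoutPair o) x y ≡ o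
      withArc∘withoutPair {o} (ao , oxy) = orientation-ext λ u v → mk⇔ (⇒o u v) (o⇒ u v (pair? a b u v))
        where
        ⇒o : ∀ u v → Arc (withArc (withoutPair o) x y) u v → Arc o u v
        ⇒o u v uv with withArc⁻ (withoutPair o) x y uv
        ... | inj₁ uv′           = proj₁ (withoutPair⁻ o uv′)
        ... | inj₂ (refl , refl) = oxy
        o⇒ : ∀ u v → Dec (Pair a b u v) → Arc o u v → Arc (withArc (withoutPair o) x y) u v
        o⇒ u v (no ¬ab)    ouv = withArc⁺ (withoutPair o) x y (inj₁ (withoutPair⁺ o ouv ¬ab))
        o⇒ u v (yes uv-ab) ouv with Pair-cases xy uv-ab
        ... | inj₁ (refl , refl) = withArc⁺ (withoutPair o) x y (inj₂ (refl , refl))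
        ... | inj₂ (refl , refl) = contradiction oxy (Acyclic⇒¬Arc (acyclic ao) ouv)

      withoutPair∘withArc : ∀ {o} → ExtendsBy x y o → withoutPair (withArc o x y) ≡ o
      withoutPair∘withArc {o} (ao , _) = orientation-ext λ u v →
        mk⇔ ⇒o (λ ouv → withoutPair⁺ (withArc o x y) (withArc⁺ o x y (inj₁ ouv)) (AO-D⇒¬Pair ao ouv))
        where
        ⇒o : ∀ {u v} → Arc (withoutPair (withArc o x y)) u v → Arc o u v
        ⇒o uv with withoutPair⁻ (withArc o x y) uv
        ... | uv′ , ¬ab with withArc⁻ o x y uv′
        ...   | inj₁ ouv           = ouv
        ...   | inj₂ (refl , refl) = contradiction xy ¬ab

      #-with-arc : #[ acyclicOrientation? G ∩? (λ o → arc? o x y) ] elements (orientations (suc m))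
                 ≡ #[ extendsBy? x y ] elements (orientations (suc m))
      #-with-arc = #-bijection (acyclicOrientation? G ∩? (λ o → arc? o x y)) (extendsBy? x y)
        (orientations (suc m)) (orientations (suc m)) withoutPair (λ o → withArc o x y)
        withoutPair-extends withArc-acyclicOrientation withArc∘withoutPair withoutPair∘withArc

    AO-D⇒extends : ∀ {o} → IsAcyclicOrientation D o → ExtendsBy a b o ⊎ ExtendsBy b a o
    AO-D⇒extends ao with acyclic ao
    ... | r , ranks with ≤-total (r a) (r b)
    ... | inj₁ ra≤rb = inj₁ (ao , Acyclic-withArc ranks a≢b ra≤rb)
    ... | inj₂ rb≤ra = inj₂ (ao , Acyclic-withArc ranks (a≢b ∘ sym) rb≤ra)

    -- If o is acyclic together with each of a → b and b → a, then no directed path joins a and b, and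
    -- o has a ranking putting a and b on one level K: below it the vertices ranked under a by r₁ or
    -- under b by r₂ (they contain all in-neighbours of a and b), above it the rest.
    module EqualRank {o : Orientation (suc m)} (ao : IsAcyclicOrientation D o)
                     {r₁ r₂ : Fin (suc m) → ℕ} (ranks₁ : Ranks (withArc o a b) r₁) (ranks₂ : Ranks (withArc o b a) r₂)
                     {K : ℕ} (r₁<K : ∀ w → r₁ w < K) where

      private
        r₁-mono : ∀ {u v} → Arc o u v → r₁ u < r₁ v
        r₁-mono = ranks₁ ∘ withArc⁺ o a b ∘ inj₁

        r₂-mono : ∀ {u v} → Arc o u v → r₂ u < r₂ v
        r₂-mono = ranks₂ ∘ withArc⁺ o b a ∘ inj₁

        r₁a<r₁b : r₁ a < r₁ b
        r₁a<r₁b = ranks₁ (withArc⁺ o a b (inj₂ (refl , refl)))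

        r₂b<r₂a : r₂ b < r₂ a
        r₂b<r₂a = ranks₂ (withArc⁺ o b a (inj₂ (refl , refl)))

      End : Fin (suc m) → Set
      End w = w ≡ a ⊎ w ≡ b

      Low : Fin (suc m) → Set
      Low w = r₁ w < r₁ a ⊎ r₂ w < r₂ b

      ρ : Fin (suc m) → ℕ
      ρ w with (w ≟ a) ⊎-dec (w ≟ b) | (r₁ w <? r₁ a) ⊎-dec (r₂ w <? r₂ b)
      ... | yes _ | _     = K
      ... | no _  | yes _ = r₁ w
      ... | no _  | no _  = K + suc (r₁ w)

      ρ-end : ∀ {w} → End w → ρ w ≡ K
      ρ-end {w} end with (w ≟ a) ⊎-dec (w ≟ b)
      ... | yes _    = refl
      ... | no ¬end  = contradiction end ¬end

      private
        Low-closed : ∀ {u v} → Arc o u v → Low v → Low u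
        Low-closed uv (inj₁ r₁v<r₁a) = inj₁ (<-trans (r₁-mono uv) r₁v<r₁a)
        Low-closed uv (inj₂ r₂v<r₂b) = inj₂ (<-trans (r₂-mono uv) r₂v<r₂b)

        into-End⇒Low : ∀ {u v} → Arc o u v → End v → Low u
        into-End⇒Low uv (inj₁ refl) = inj₁ (r₁-mono uv)
        into-End⇒Low uv (inj₂ refl) = inj₂ (r₂-mono uv)

        out-of-End⇒¬Low : ∀ {u v} → Arc o u v → End u → ¬ Low v
        out-of-End⇒¬Low uv (inj₁ refl) (inj₁ r₁v<r₁a) = <-asym (r₁-mono uv) r₁v<r₁a
        out-of-End⇒¬Low uv (inj₁ refl) (inj₂ r₂v<r₂b) = <-asym (<-trans r₂b<r₂a (r₂-mono uv)) r₂v<r₂b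
        out-of-End⇒¬Low uv (inj₂ refl) (inj₁ r₁v<r₁a) = <-asym (<-trans r₁a<r₁b (r₁-mono uv)) r₁v<r₁a
        out-of-End⇒¬Low uv (inj₂ refl) (inj₂ r₂v<r₂b) = <-asym (r₂-mono uv) r₂v<r₂b

        ¬End-End : ∀ {u v} → Arc o u v → End u → End v → ⊥
        ¬End-End {u} {v} uv u-end v-end = AO-D⇒¬Pair ao uv (pair u-end v-end)
          where
          pair : End u → End v → Pair a b u v
          pair (inj₁ refl) (inj₁ refl) = contradiction refl (Adj⇒≢ D (arc⇒adj ao u v uv))
          pair (inj₁ refl) (inj₂ refl) = inj₁ (refl , refl)
          pair (inj₂ refl) (inj₁ refl) = inj₂ (refl , refl)
          pair (inj₂ refl) (inj₂ refl) = contradiction refl (Adj⇒≢ D (arc⇒adj ao u v uv))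

      ρ-ranks : Ranks o ρ
      ρ-ranks {u} {v} uv
        with (u ≟ a) ⊎-dec (u ≟ b) | (r₁ u <? r₁ a) ⊎-dec (r₂ u <? r₂ b)
           | (v ≟ a) ⊎-dec (v ≟ b) | (r₁ v <? r₁ a) ⊎-dec (r₂ v <? r₂ b)
      ... | yes u-end | _        | yes v-end | _        = ⊥-elim (¬End-End uv u-end v-end)
      ... | yes u-end | _        | no _      | yes v-low = contradiction v-low (out-of-End⇒¬Low uv u-end)
      ... | yes _     | _        | no _      | no _     = m<m+n K z<s
      ... | no _      | yes _    | yes _     | _        = r₁<K u
      ... | no _      | yes _    | no _      | yes _    = r₁-mono uv
      ... | no _      | yes _    | no _      | no _     = <-≤-trans (r₁<K u) (m≤m+n K _)
      ... | no _      | no u-high | yes v-end | _       = contradiction (into-End⇒Low uv v-end) u-high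
      ... | no _      | no u-high | no _     | yes v-low = contradiction (Low-closed uv v-low) u-high
      ... | no _      | no _     | no _      | no _     = +-monoʳ-< K (s≤s (r₁-mono uv))

      ρa≡ρb : ρ a ≡ ρ b
      ρa≡ρb = trans (ρ-end (inj₁ refl)) (sym (ρ-end (inj₂ refl)))

    equal-ranking : ∀ {o} → ExtendsBy a b o × ExtendsBy b a o → ∃ λ ρ → Ranks o ρ × ρ a ≡ ρ b
    equal-ranking ((ao , r₁ , ranks₁) , (_ , r₂ , ranks₂)) = ρ , ρ-ranks , ρa≡ρb
      where
      open Normalise r₁
      open EqualRank ao (normalise-mono ∘ ranks₁) ranks₂ normalise<n

    down : Orientation (suc m) → Orientation m
    down o = orientationOf λ x y → any? λ u → any? λ v → (π u ≟ x) ×-dec (π v ≟ y) ×-dec arc? o u v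

    Arc-down : ∀ o {x y} → Arc (down o) x y ⇔ (∃₂ λ u v → π u ≡ x × π v ≡ y × Arc o u v)
    Arc-down o = Arc-orientationOf λ x y → any? λ u → any? λ v → (π u ≟ x) ×-dec (π v ≟ y) ×-dec arc? o u v

    up : Orientation m → Orientation (suc m)
    up o = orientationOf λ u v → adj? D u v ×-dec arc? o (π u) (π v)

    Arc-up : ∀ o {u v} → Arc (up o) u v ⇔ (Adj D u v × Arc o (π u) (π v))
    Arc-up o = Arc-orientationOf λ u v → adj? D u v ×-dec arc? o (π u) (π v)

    ⇒down : ∀ {o u v} → Arc o u v → Arc (down o) (π u) (π v)
    ⇒down {o} {u} {v} uv = Equivalence.from (Arc-down o) (u , v , refl , refl , uv)

    down-ranks : ∀ {o ρ} → Ranks o ρ → ρ a ≡ ρ b → Ranks (down o) (ρ ∘ ι)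
    down-ranks {o} {ρ} ranks ρa≡ρb xy with Equivalence.to (Arc-down o) xy
    ... | u , v , refl , refl , uv =
      subst₂ _<_ (sym (ι∘π-invariant ρ ρa≡ρb u)) (sym (ι∘π-invariant ρ ρa≡ρb v)) (ranks uv)

    down-acyclic : ∀ {o} → ExtendsBy a b o × ExtendsBy b a o → Acyclic (down o)
    down-acyclic both = let (ρ , ranks , ρa≡ρb) = equal-ranking both in ρ ∘ ι , down-ranks ranks ρa≡ρb

    down-acyclicOrientation : ∀ {o} → ExtendsBy a b o × ExtendsBy b a o → IsAcyclicOrientation C (down o)
    down-acyclicOrientation {o} both@((ao , _) , _) = record
      { arc⇒adj = λ x y xy → arc⇒adj′ (Equivalence.to (Arc-down o) xy)
      ; adj⇒arc = λ x y xy → adj⇒arc′ (Equivalence.to Adj-C xy)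
      ; acyclic = down-acyclic both
      }
      where
      arc⇒adj′ : ∀ {x y} → ∃₂ (λ u v → π u ≡ x × π v ≡ y × Arc o u v) → Adj C x y
      arc⇒adj′ (u , v , refl , refl , uv) = Adj-D⇒Adj-C (arc⇒adj ao u v uv)
      adj⇒arc′ : ∀ {x y} → _ × ∃₂ (λ u v → π u ≡ x × π v ≡ y × Adj D u v) → Arc (down o) x y ⊎ Arc (down o) y x
      adj⇒arc′ (_ , u , v , refl , refl , uv) = Data.Sum.map ⇒down ⇒down (adj⇒arc ao u v uv)

    up-extends : ∀ {o} → IsAcyclicOrientation C o → ExtendsBy a b (up o) × ExtendsBy b a (up o)
    up-extends {o} ao = (ao-D , Acyclic-withArc ranks a≢b (≤-reflexive r-equal))
                      , (ao-D , Acyclic-withArc ranks (a≢b ∘ sym) (≤-reflexive (sym r-equal)))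
      where
      r = proj₁ (acyclic ao)
      ranks : Ranks (up o) (r ∘ π)
      ranks uv = proj₂ (acyclic ao) (proj₂ (Equivalence.to (Arc-up o) uv))
      r-equal : r (π a) ≡ r (π b)
      r-equal = cong r π-a≡π-b
      ao-D : IsAcyclicOrientation D (up o)
      ao-D = record
        { arc⇒adj = λ u v uv → proj₁ (Equivalence.to (Arc-up o) uv)
        ; adj⇒arc = λ u v uv → Data.Sum.map (λ πuv → Equivalence.from (Arc-up o) (uv , πuv))
                                             (λ πvu → Equivalence.from (Arc-up o) (Adj-sym D uv , πvu))
                                             (adj⇒arc ao (π u) (π v) (Adj-D⇒Adj-C uv))
        ; acyclic = r ∘ π , ranks
        }

    down∘up : ∀ {o} → IsAcyclicOrientation C o → down (up o) ≡ o
    down∘up {o} ao = orientation-ext λ x y → mk⇔ ⇒o (o⇒ x y)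
      where
      ⇒o : ∀ {x y} → Arc (down (up o)) x y → Arc o x y
      ⇒o xy with Equivalence.to (Arc-down (up o)) xy
      ... | u , v , refl , refl , uv = proj₂ (Equivalence.to (Arc-up o) uv)
      o⇒ : ∀ x y → Arc o x y → Arc (down (up o)) x y
      o⇒ x y xy with Equivalence.to Adj-C (arc⇒adj ao x y xy)
      ... | _ , u , v , refl , refl , uv = ⇒down (Equivalence.from (Arc-up o) (uv , xy))

    up∘down : ∀ {o} → ExtendsBy a b o × ExtendsBy b a o → up (down o) ≡ o
    up∘down {o} both@((ao , _) , _) = orientation-ext λ u v →
      mk⇔ (⇒o u v) (λ uv → Equivalence.from (Arc-up (down o)) (arc⇒adj ao u v uv , ⇒down uv))
      where
      ⇒o : ∀ u v → Arc (up (down o)) u v → Arc o u v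
      ⇒o u v uv with Equivalence.to (Arc-up (down o)) uv
      ... | adj-uv , down-uv with adj⇒arc ao u v adj-uv
      ...   | inj₁ ouv = ouv
      ...   | inj₂ ovu = contradiction (⇒down ovu) (Acyclic⇒¬Arc (down-acyclic both) down-uv)

    AO-deletion-contraction : AO G ≡ AO D + AO C
    AO-deletion-contraction = begin
      #[ ao? G ] os
        ≡⟨ #-split (ao? G) (λ o → arc? o a b) os ⟩
      #[ ao? G ∩? (λ o → arc? o a b) ] os + #[ ao? G ∩? ∁? (λ o → arc? o a b) ] os
        ≡⟨ cong (#[ ao? G ∩? (λ o → arc? o a b) ] os +_)
                (#-cong (ao? G ∩? ∁? (λ o → arc? o a b)) (ao? G ∩? (λ o → arc? o b a)) ¬ab⇔ba os) ⟩
      #[ ao? G ∩? (λ o → arc? o a b) ] os + #[ ao? G ∩? (λ o → arc? o b a) ] os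
        ≡⟨ cong₂ _+_ (Deletion.#-with-arc (inj₁ (refl , refl))) (Deletion.#-with-arc (inj₂ (refl , refl))) ⟩
      #[ extendsBy? a b ] os + #[ extendsBy? b a ] os
        ≡⟨ #-union+inter (extendsBy? a b) (extendsBy? b a) os ⟩
      #[ extendsBy? a b ∪? extendsBy? b a ] os + #[ extendsBy? a b ∩? extendsBy? b a ] os
        ≡⟨ cong₂ _+_ (#-cong (extendsBy? a b ∪? extendsBy? b a) (ao? D) (λ o → mk⇔ [ proj₁ , proj₁ ]′ AO-D⇒extends) os)
                     contracted ⟩
      AO D + AO C ∎
      where
      open ≡-Reasoning
      os = elements (orientations (suc m))
      ao? = acyclicOrientation?
      ¬ab⇔ba : ∀ o → (IsAcyclicOrientation G o × ¬ Arc o a b) ⇔ (IsAcyclicOrientation G o × Arc o b a)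
      ¬ab⇔ba o = mk⇔ (λ (ao , ¬ab) → ao , [ (λ ab′ → contradiction ab′ ¬ab) , (λ ba → ba) ]′ (adj⇒arc ao a b ab))
                     (λ (ao , ba) → ao , Acyclic⇒¬Arc (acyclic ao) ba)
      contracted : #[ extendsBy? a b ∩? extendsBy? b a ] os ≡ AO C
      contracted = #-bijection (extendsBy? a b ∩? extendsBy? b a) (ao? C) (orientations (suc m)) (orientations m)
        down up down-acyclicOrientation up-extends up∘down down∘up

module Stanley where

  open import Defs hiding (sym)
  open Counting
  open Polynomial
  open Graphs
  open Orientations
  open DeletionContraction
  open import Data.Nat as ℕ using (ℕ; zero; suc)
  open import Data.Integer as ℤ using (ℤ; +_; -_; _*_; _-_)
  import Data.Integer.Properties as ℤ
  open import Data.Integer.Tactic.RingSolver using (solve-∀)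
  open import Data.Fin using (Fin)
  open import Data.List using (List; []; _∷_; length; allFin; cartesianProduct)
  open import Data.List.Properties using (length-tabulate)
  open import Data.List.Membership.Propositional using (_∈_)
  open import Data.List.Membership.Propositional.Properties using (∈-allFin; ∈-cartesianProduct⁺)
  open import Data.List.Relation.Unary.Any using (here; there)
  open import Data.List.Relation.Unary.All using ([])
  open import Data.List.Relation.Unary.AllPairs using ([]; _∷_)
  open import Data.Product using (Σ; _×_; _,_)
  open import Data.Sum using (inj₁)
  open import Data.Unit using (⊤; tt)
  open import Data.Empty using (⊥)
  open import Function.Bundles using (mk⇔; Equivalence)
  open import Relation.Binary.PropositionalEquality
    using (_≡_; _≢_; refl; sym; trans; cong; cong₂; module ≡-Reasoning)
  open import Relation.Nullary using (¬_; Dec; yes; no; contradiction)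

  private variable
    n : ℕ

  StanleyPolynomial : Graph n → Set
  StanleyPolynomial {n} G = Σ Poly λ P → IsChromaticPoly G P × (negOnePow n * eval P (- + 1) ≡ + AO G)

  module Edgeless (G : Graph n) (no-edges : ∀ u v → ¬ Adj G u v) where

    numColourings-edgeless : ∀ q → numColourings G q ≡ q ℕ.^ n
    numColourings-edgeless q = begin
      numColourings G q                         ≡⟨ numColourings≡ G q ⟩
      #[ proper? G ] elements (finVectors n q)  ≡⟨ #-all (proper? G) (elements (finVectors n q)) all-proper ⟩
      length (vectors (allFin q) n)             ≡⟨ length-vectors (allFin q) n ⟩
      length (allFin q) ℕ.^ n                   ≡⟨ cong (ℕ._^ n) (length-tabulate (λ x → x)) ⟩
      q ℕ.^ n                                   ∎
      where
      open ≡-Reasoning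
      all-proper : ∀ c → Proper G c
      all-proper c u v uv = contradiction uv (no-edges u v)

    private
      none? : (u v : Fin n) → Dec ⊥
      none? _ _ = no λ ()

    empty : Orientation n
    empty = orientationOf none?

    no-arcs : ∀ {u v} → ¬ Arc empty u v
    no-arcs = Equivalence.to (Arc-orientationOf none?)

    empty-acyclicOrientation : IsAcyclicOrientation G empty
    empty-acyclicOrientation = record
      { arc⇒adj = λ u v uv → contradiction uv no-arcs
      ; adj⇒arc = λ u v uv → contradiction uv (no-edges u v)
      ; acyclic = (λ _ → 0) , λ uv → contradiction uv no-arcs
      }

    AO-edgeless : AO G ≡ 1
    AO-edgeless = #-bijection (acyclicOrientation? G) (λ _ → yes tt) (orientations n) single
      (λ _ → tt) (λ _ → empty) (λ _ → tt) (λ _ → empty-acyclicOrientation)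
      (λ ao → orientation-ext λ u v → mk⇔
         (λ uv → contradiction uv no-arcs)
         (λ uv → contradiction (arc⇒adj ao u v uv) (no-edges u v)))
      (λ _ → refl)
      where
      single : Enumeration ⊤
      single = record { elements = tt ∷ [] ; unique = [] ∷ [] ; complete = λ _ → here refl }

    stanley-edgeless : StanleyPolynomial G
    stanley-edgeless = monomial n
      , (λ q → trans (eval-monomial-ℕ n q) (cong +_ (sym (numColourings-edgeless q))))
      , trans (cong (negOnePow n *_) (eval-monomial-−1 n)) (trans (negOnePow-square n) (cong +_ (sym AO-edgeless)))

  stanley-step : ∀ {m} (G : Graph (suc m)) {a b} (a≢b : a ≢ b) (ab : Adj G a b) →
                 StanleyPolynomial (delete G a b) → StanleyPolynomial (contract G a b a≢b) → StanleyPolynomial G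
  stanley-step {m} G a≢b ab (P , P-chromatic , P-AO) (Q , Q-chromatic , Q-AO) = P ⊖ Q , chromatic , at-minus-one
    where
    open AlongEdge G a≢b ab
    chromatic : IsChromaticPoly G (P ⊖ Q)
    chromatic q = begin
      eval (P ⊖ Q) (+ q)
        ≡⟨ eval-⊖ P Q (+ q) ⟩
      eval P (+ q) - eval Q (+ q)
        ≡⟨ cong₂ _-_ (P-chromatic q) (Q-chromatic q) ⟩
      + numColourings D q - + numColourings C q
        ≡⟨ cong (λ k → + k - + numColourings C q) (colour-deletion-contraction q) ⟩
      + (numColourings G q ℕ.+ numColourings C q) - + numColourings C q
        ≡⟨ cancel (numColourings G q) (numColourings C q) ⟩
      + numColourings G q ∎
      where
      open ≡-Reasoning
      cancel : ∀ x y → + (x ℕ.+ y) - + y ≡ + x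
      cancel x y = trans (cong (_- + y) (ℤ.pos-+ x y)) (lemma (+ x) (+ y))
        where
        lemma : ∀ i j → (i ℤ.+ j) - j ≡ i
        lemma = solve-∀
    at-minus-one : negOnePow (suc m) * eval (P ⊖ Q) (- + 1) ≡ + AO G
    at-minus-one = begin
      negOnePow (suc m) * eval (P ⊖ Q) (- + 1)
        ≡⟨ cong (negOnePow (suc m) *_) (eval-⊖ P Q (- + 1)) ⟩
      - negOnePow m * (eval P (- + 1) - eval Q (- + 1))
        ≡⟨ sign-flip (negOnePow m) (eval P (- + 1)) (eval Q (- + 1)) ⟩
      negOnePow (suc m) * eval P (- + 1) ℤ.+ negOnePow m * eval Q (- + 1)
        ≡⟨ cong₂ ℤ._+_ P-AO Q-AO ⟩
      + AO D ℤ.+ + AO C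
        ≡⟨ sym (cong +_ AO-deletion-contraction) ⟩
      + AO G ∎
      where
      open ≡-Reasoning
      sign-flip : ∀ s p q → (- s) * (p - q) ≡ (- s) * p ℤ.+ s * q
      sign-flip = solve-∀

  private
    allPairs : ∀ n → List (Fin n × Fin n)
    allPairs n = cartesianProduct (allFin n) (allFin n)

    EdgesIn : Graph n → List (Fin n × Fin n) → Set
    EdgesIn G L = ∀ u v → Adj G u v → (u , v) ∈ L

  -- Induction on the number of vertices and, for a fixed number, on a list of pairs containing every edge.
  stanley : (G : Graph n) → StanleyPolynomial G
  stanley {zero}  G = Edgeless.stanley-edgeless G λ ()
  stanley {suc m} G = by-edges (allPairs (suc m)) G (λ u v _ → ∈-cartesianProduct⁺ (∈-allFin u) (∈-allFin v))
    where
    by-edges : ∀ L (G : Graph (suc m)) → EdgesIn G L → StanleyPolynomial G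
    by-edges [] G edges = Edgeless.stanley-edgeless G λ u v uv → contradiction (edges u v uv) λ ()
    by-edges ((a , b) ∷ L) G edges with adj? G a b
    ... | yes ab = stanley-step G a≢b ab (by-edges L (delete G a b) edges-D) (stanley (contract G a b a≢b))
      where
      a≢b : a ≢ b
      a≢b = Adj⇒≢ G ab
      edges-D : EdgesIn (delete G a b) L
      edges-D u v uv with Equivalence.to (Adj-delete G a b) uv
      ... | uv-G , ¬ab with edges u v uv-G
      ...   | here refl  = contradiction (inj₁ (refl , refl)) ¬ab
      ...   | there uv∈L = uv∈L
    ... | no ¬ab = by-edges L G edges-G
      where
      edges-G : EdgesIn G L
      edges-G u v uv with edges u v uv
      ... | here refl  = contradiction uv ¬ab
      ... | there uv∈L = uv∈L

  stanley-theorem : (G : Graph n) (P : Poly) → IsChromaticPoly G P → negOnePow n * eval P (- + 1) ≡ + AO G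
  stanley-theorem {n} G P P-chromatic with stanley G
  ... | Q , Q-chromatic , Q-AO =
    trans (cong (negOnePow n *_) (polynomial-identity P Q (λ q → trans (P-chromatic q) (sym (Q-chromatic q))) (- + 1))) Q-AO

module Hamiltonian where

  open import Defs hiding (sym)
  open Counting
  open Graphs
  open Orientations
  open import Data.Nat as ℕ using (ℕ; zero; suc; _≤_; _<_; z≤n; s≤s)
  open import Data.Nat.Properties as ℕ using (≤-antisym; <-≤-trans; 0≢1+n; suc-injective; n≮0)
  open import Data.Fin as Fin using (Fin; zero; suc; toℕ; inject₁; punchOut)
  import Data.Fin.Properties as Fin
  open import Data.Fin.Properties
    using (_≟_; any?; toℕ-injective; toℕ-inject₁; punchOut-injective; injective⇒≤)
  open import Data.Fin.Induction using (<-weakInduction)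
  open import Data.Vec using (Vec; []; _∷_; lookup; tabulate)
  open import Data.Vec.Properties using (lookup∘tabulate)
  open import Data.Vec.Relation.Binary.Pointwise.Extensional using (ext; Pointwise-≡⇒≡)
  open import Data.Vec.Relation.Unary.Linked using (Linked; []; [-]; _∷_)
  open import Data.Product using (∃; _,_; proj₁; proj₂)
  open import Data.Sum using (_⊎_; inj₁; inj₂; [_,_]′)
  open import Function.Base using (_∘_)
  open import Function.Bundles using (Equivalence)
  open import Function.Definitions using (Injective)
  open import Relation.Binary.PropositionalEquality
    using (_≡_; _≢_; refl; sym; trans; cong; subst; subst₂)
  open import Relation.Nullary using (¬_; Dec; yes; no; contradiction; _⊎-dec_)

  private variable
    n : ℕ

  injective⇒surjective : (w : Vec (Fin n) n) → Injective _≡_ _≡_ (lookup w) → ∀ u → ∃ λ i → lookup w i ≡ u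
  injective⇒surjective {suc n} w inj u with any? (λ i → lookup w i ≟ u)
  ... | yes found = found
  ... | no missed = contradiction (injective⇒≤ {f = skip-u} skip-u-injective) (ℕ.<-irrefl refl)
    where
    u≢w : ∀ i → u ≢ lookup w i
    u≢w i u≡wi = missed (i , sym u≡wi)
    skip-u : Fin (suc n) → Fin n
    skip-u i = punchOut (u≢w i)
    skip-u-injective : Injective _≡_ _≡_ skip-u
    skip-u-injective {i} {j} eq = inj (punchOut-injective (u≢w i) (u≢w j) eq)

  Linked⇒consecutive : ∀ {A : Set} {R : A → A → Set} {k} {w : Vec A (suc k)} → Linked R w →
                       ∀ i → R (lookup w (inject₁ i)) (lookup w (suc i))
  Linked⇒consecutive {w = _ ∷ _ ∷ _} (r ∷ _)    zero    = r
  Linked⇒consecutive {w = _ ∷ _ ∷ _} (_ ∷ rest) (suc i) = Linked⇒consecutive rest i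

  index≤rank : ∀ {m k} {o : Orientation m} {r : Fin m → ℕ} → Ranks o r → (w : Vec (Fin m) (suc k)) →
               (∀ i → Arc o (lookup w (inject₁ i)) (lookup w (suc i))) → ∀ i → toℕ i ≤ r (lookup w i)
  index≤rank {r = r} ranks w arcs = <-weakInduction (λ i → toℕ i ≤ r (lookup w i)) z≤n
    λ i i≤r → <-≤-trans (s≤s (subst (_≤ r (lookup w (inject₁ i))) (toℕ-inject₁ i) i≤r)) (ranks (arcs i))

  module HamiltonianPaths {n : ℕ} (G : Graph (suc n)) where

    private
      V = Fin (suc n)

    -- The index of u in w, or zero if u does not occur in w.
    position : Vec V (suc n) → V → V
    position w u with any? (λ i → lookup w i ≟ u)
    ... | yes (i , _) = i
    ... | no _        = zero

    lookup-position : ∀ w {u} → (∃ λ i → lookup w i ≡ u) → lookup w (position w u) ≡ u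
    lookup-position w {u} found with any? (λ i → lookup w i ≟ u)
    ... | yes (_ , wi≡u) = wi≡u
    ... | no missed      = contradiction found missed

    pathOrientation : Vec V (suc n) → Orientation (suc n)
    pathOrientation w = byRank G (toℕ ∘ position w)

    module Path {w : Vec V (suc n)} (ham : HamiltonianPath G w) where

      position-inverseˡ : ∀ u → lookup w (position w u) ≡ u
      position-inverseˡ u = lookup-position w (injective⇒surjective w (proj₁ ham) u)

      position-inverseʳ : ∀ i → position w (lookup w i) ≡ i
      position-inverseʳ i = proj₁ ham (position-inverseˡ (lookup w i))

      pathOrientation-acyclic : IsAcyclicOrientation G (pathOrientation w)
      pathOrientation-acyclic = byRank-acyclicOrientation G (toℕ ∘ position w) λ {u} {v} uv pu≡pv →
        Adj⇒≢ G uv (trans (sym (position-inverseˡ u)) (trans (cong (lookup w) (toℕ-injective pu≡pv)) (position-inverseˡ v)))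

      path-arcs : ∀ i → Arc (pathOrientation w) (lookup w (inject₁ i)) (lookup w (suc i))
      path-arcs i = Equivalence.from (Arc-byRank G (toℕ ∘ position w))
        ( Linked⇒consecutive (proj₂ ham) i
        , subst₂ _<_ (sym (trans (cong toℕ (position-inverseʳ (inject₁ i))) (toℕ-inject₁ i)))
                     (sym (cong toℕ (position-inverseʳ (suc i)))) ℕ.≤-refl )

      has-in-arc : ∀ u → u ≢ lookup w zero → ∃ λ x → Arc (pathOrientation w) x u
      has-in-arc u u≢w₀ with position w u in pos-u
      ... | zero  = contradiction (trans (sym (position-inverseˡ u)) (cong (lookup w) pos-u)) u≢w₀
      ... | suc i = lookup w (inject₁ i) , subst (Arc _ _) (trans (cong (lookup w) (sym pos-u)) (position-inverseˡ u)) (path-arcs i)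

    -- Two Hamiltonian paths inducing the same orientation coincide: the position of the i-th vertex of one
    -- path in the other is at least i, and symmetrically at most i.
    pathOrientation-injective : ∀ {w w′} → HamiltonianPath G w → HamiltonianPath G w′ →
                                pathOrientation w ≡ pathOrientation w′ → w ≡ w′
    pathOrientation-injective {w} {w′} ham ham′ same = Pointwise-≡⇒≡ (ext same-entry)
      where
      module P = Path ham
      module P′ = Path ham′
      i≤position : ∀ i → toℕ i ≤ toℕ (position w (lookup w′ i))
      i≤position = index≤rank (proj₂ (acyclic P.pathOrientation-acyclic)) w′
                     (λ i → subst (λ o → Arc o (lookup w′ (inject₁ i)) (lookup w′ (suc i))) (sym same) (P′.path-arcs i))
      i≤position′ : ∀ i → toℕ i ≤ toℕ (position w′ (lookup w i))
      i≤position′ = index≤rank (proj₂ (acyclic P′.pathOrientation-acyclic)) w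
                      (λ i → subst (λ o → Arc o (lookup w (inject₁ i)) (lookup w (suc i))) same (P.path-arcs i))
      same-entry : ∀ i → lookup w i ≡ lookup w′ i
      same-entry i = trans (cong (lookup w) i≡j) (P.position-inverseˡ (lookup w′ i))
        where
        j = position w (lookup w′ i)
        j≤i : toℕ j ≤ toℕ i
        j≤i = subst (λ k → toℕ j ≤ toℕ k)
                    (trans (cong (position w′) (P.position-inverseˡ (lookup w′ i))) (P′.position-inverseʳ i))
                    (i≤position′ j)
        i≡j : i ≡ j
        i≡j = toℕ-injective (≤-antisym (i≤position i) j≤i)

    private
      paths : Enumeration (Vec V (suc n))
      paths = finVectors (suc n) (suc n)

      HP≡ : HP G ≡ #[ hamiltonian? G ] elements paths
      HP≡ = cong (count (isHamPath G)) (allVecs≡finVectors (suc n) (suc n))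

    HP≤AO : HP G ≤ AO G
    HP≤AO = subst (_≤ AO G) (sym HP≡)
      (#-≤-injection (hamiltonian? G) (acyclicOrientation? G) (λ w _ → pathOrientation w)
         (λ _ ham → Path.pathOrientation-acyclic ham) pathOrientation-injective
         (unique paths) (complete (orientations (suc n))))

    module NonComplete {u v : V} (¬uv : ¬ Adj G u v) (u≢v : u ≢ v) where

      private
        Source : V → Set
        Source x = x ≡ u ⊎ x ≡ v

        source? : ∀ x → Dec (Source x)
        source? x = (x ≟ u) ⊎-dec (x ≟ v)

        sources-nonadjacent : ∀ {x y} → Source x → Source y → ¬ Adj G x y
        sources-nonadjacent (inj₁ refl) (inj₁ refl) xy = Adj⇒≢ G xy refl
        sources-nonadjacent (inj₁ refl) (inj₂ refl) xy = ¬uv xy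
        sources-nonadjacent (inj₂ refl) (inj₁ refl) xy = ¬uv (Adj-sym G xy)
        sources-nonadjacent (inj₂ refl) (inj₂ refl) xy = Adj⇒≢ G xy refl

      -- Both u and v get the least rank, so both are sources of the orientation.
      ρ : V → ℕ
      ρ x with source? x
      ... | yes _ = 0
      ... | no _  = suc (toℕ x)

      ρ-separates : ∀ {x y} → Adj G x y → ρ x ≢ ρ y
      ρ-separates {x} {y} xy with source? x | source? y
      ... | yes x-source | yes y-source = λ _ → sources-nonadjacent x-source y-source xy
      ... | yes _        | no _         = λ ()
      ... | no _         | yes _        = λ ()
      ... | no _         | no _         = Adj⇒≢ G xy ∘ toℕ-injective ∘ suc-injective

      twoSources : Orientation (suc n)
      twoSources = byRank G ρ

      twoSources-acyclic : IsAcyclicOrientation G twoSources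
      twoSources-acyclic = byRank-acyclicOrientation G ρ ρ-separates

      no-in-arc : ∀ {x y} → Source y → ¬ Arc twoSources x y
      no-in-arc {x} {y} y-source xy with source? y | proj₂ (Equivalence.to (Arc-byRank G ρ) xy)
      ... | yes _ | ρx<0 = n≮0 ρx<0
      ... | no ¬y-source | _ = ¬y-source y-source

      not-a-path : ∀ w → HamiltonianPath G w → pathOrientation w ≢ twoSources
      not-a-path w ham same with u ≟ lookup w zero
      ... | yes u≡w₀ = let (x , xv) = Path.has-in-arc ham v (λ v≡w₀ → u≢v (trans u≡w₀ (sym v≡w₀))) in
                       no-in-arc (inj₂ refl) (subst (λ o → Arc o x v) same xv)
      ... | no u≢w₀  = let (x , xu) = Path.has-in-arc ham u u≢w₀ in
                       no-in-arc (inj₁ refl) (subst (λ o → Arc o x u) same xu)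

    HP<AO : ∀ {u v} → ¬ Adj G u v → u ≢ v → HP G < AO G
    HP<AO ¬uv u≢v = subst (_< AO G) (sym HP≡)
      (#-<-injection (hamiltonian? G) (acyclicOrientation? G) (λ w _ → pathOrientation w)
         (λ _ ham → Path.pathOrientation-acyclic ham) pathOrientation-injective
         (unique paths) (complete (orientations (suc n)))
         twoSources twoSources-acyclic not-a-path)
      where open NonComplete ¬uv u≢v

    module CompleteGraph (G-complete : Complete G) where

      private
        Linked-distinct : ∀ {k} (w : Vec V k) → Injective _≡_ _≡_ (lookup w) → Linked (Adj G) w
        Linked-distinct []          _   = []
        Linked-distinct (x ∷ [])    _   = [-]
        Linked-distinct (x ∷ y ∷ w) inj =
          G-complete x y (λ x≡y → 0≢1+n (cong toℕ (inj {zero} {suc zero} x≡y))) ∷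
          Linked-distinct (y ∷ w) (Fin.suc-injective ∘ inj)

      -- An acyclic orientation of a complete graph ranks all vertices differently; listing them by rank is a
      -- Hamiltonian path inducing the orientation.
      module FromOrientation {o : Orientation (suc n)} (ao : IsAcyclicOrientation G o) where

        open Normalise (proj₁ (acyclic ao))

        R : Vec V (suc n)
        R = rankVector

        R-ranks : Ranks o (toℕ ∘ lookup R)
        R-ranks xy = subst₂ _<_ (sym (toℕ-rankVector _)) (sym (toℕ-rankVector _)) (normalise-mono (proj₂ (acyclic ao) xy))

        R-injective : Injective _≡_ _≡_ (lookup R)
        R-injective {x} {y} Rx≡Ry with x ≟ y
        ... | yes x≡y = x≡y
        ... | no x≢y  = contradiction (cong toℕ Rx≡Ry)
                          ([ ℕ.<⇒≢ ∘ R-ranks , (λ yx → ℕ.<⇒≢ (R-ranks yx) ∘ sym) ]′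
                           (adj⇒arc ao x y (G-complete x y x≢y)))

        path : Vec V (suc n)
        path = tabulate (position R)

        lookup-path : ∀ i → lookup path i ≡ position R i
        lookup-path = lookup∘tabulate (position R)

        R∘path : ∀ i → lookup R (lookup path i) ≡ i
        R∘path i = trans (cong (lookup R) (lookup-path i)) (lookup-position R (injective⇒surjective R R-injective i))

        path-hamiltonian : HamiltonianPath G path
        path-hamiltonian = path-injective , Linked-distinct path path-injective
          where
          path-injective : Injective _≡_ _≡_ (lookup path)
          path-injective {i} {j} eq = trans (sym (R∘path i)) (trans (cong (lookup R) eq) (R∘path j))

        position-path : ∀ x → position path x ≡ lookup R x
        position-path x = proj₁ path-hamiltonian (trans (Path.position-inverseˡ path-hamiltonian x)
                                                        (sym (R-injective (R∘path (lookup R x)))))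

        pathOrientation-path : pathOrientation path ≡ o
        pathOrientation-path = byRank-ranking ao λ {x} {y} xy →
          subst₂ _<_ (sym (cong toℕ (position-path x))) (sym (cong toℕ (position-path y))) (R-ranks xy)

      AO≤HP : AO G ≤ HP G
      AO≤HP = subst (AO G ≤_) (sym HP≡)
        (#-≤-injection (acyclicOrientation? G) (hamiltonian? G) (λ _ ao → FromOrientation.path ao)
           (λ _ ao → FromOrientation.path-hamiltonian ao)
           (λ ao ao′ eq → trans (sym (FromOrientation.pathOrientation-path ao))
                               (trans (cong pathOrientation eq) (FromOrientation.pathOrientation-path ao′)))
           (unique (orientations (suc n))) (complete paths))

open import Defs
open Graphs using (adj?)
open Orientations using (AO)
open Stanley using (stanley-theorem)
open Hamiltonian using (module HamiltonianPaths)
open import Data.Nat using (ℕ; suc; _≥_)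
open import Data.Nat.Properties using (≤-antisym; <⇒≢)
open import Data.Integer using (+_; -_; _*_; _≤_; +≤+)
open import Data.Integer.Properties using (+-injective)
open import Data.Product using (_×_; _,_)
open import Function.Bundles using (_⇔_; mk⇔)
open import Relation.Binary.PropositionalEquality using (_≡_; cong)
open import Relation.Nullary using (yes; no; contradiction)

corollary2p3p6 : (n : ℕ) → n ≥ 1 → (G : Graph n) → Connected G →
    (P : Poly) → IsChromaticPoly G P →
    (+ HP G ≤ negOnePow n * eval P (- + 1)) ×
    ((+ HP G ≡ negOnePow n * eval P (- + 1)) ⇔ Complete G)
corollary2p3p6 (suc n) _ G _ P P-chromatic rewrite stanley-theorem G P P-chromatic =
  +≤+ HP≤AO , mk⇔ equal⇒complete (λ complete → cong +_ (≤-antisym HP≤AO (CompleteGraph.AO≤HP complete)))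
  where
  open HamiltonianPaths G
  equal⇒complete : + HP G ≡ + AO G → Complete G
  equal⇒complete HP≡AO u v u≢v with adj? G u v
  ... | yes uv = uv
  ... | no ¬uv = contradiction (+-injective HP≡AO) (<⇒≢ (HP<AO ¬uv u≢v))
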